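{- Let $n=p^\alpha q^\beta$ where $p<q$ are primes and $\alpha,\beta$ are positive integers, and set $t=p^{\alpha-1}q^{\beta-1}-1$. Then the Laplacian eigenvalues of the comaximal graph $\Gamma(\mathbb{Z}_n)$ are: $n$ with multiplicity $\phi(n)$; $(t+1)(p-1)+\phi(n)$ with multiplicity $(t+1)(q-1)-1$; $(t+1)(q-1)+\phi(n)$ with multiplicity $(t+1)(p-1)-1$; $\phi(n)$ with multiplicity $t+1$; and $(t+1)(p+q-2)+\phi(n)$ and $0$, each with multiplicity $1$.
   Context: The comaximal graph $\Gamma(\mathbb{Z}_n)$ has vertex set $\mathbb{Z}_n=\{0,1,\dots,n-1\}$, distinct $x,y$ adjacent iff $\langle x\rangle+\langle y\rangle=\mathbb{Z}_n$. Its Laplacian matrix is $L=D-A$ ($D$ diagonal degree matrix, $A$ adjacency matrix). $\phi$ is Euler's totient function. A multiplicity of $0$ means the value does not occur. -}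

module Defs where

open import Data.Nat as ℕ using (ℕ; zero; suc; _≡ᵇ_)
open import Data.Nat.DivMod using (_%_)
open import Data.Nat.GCD using (gcd)
open import Data.Integer as ℤ using (ℤ; +_; -_; _-_)
open import Data.Fin using (Fin; zero; suc; toℕ; punchIn; _≟_)
open import Data.Bool using (Bool; true; false; if_then_else_; not; _∧_)
open import Data.List using (List; upTo; filter; length)
open import Data.Bool.ListAction using (any)
open import Relation.Nullary using (does)

φ : ℕ → ℕ
φ n = length (filter (λ k → gcd (suc k) n ℕ.≟ 1) (upTo n))

Mat : ℕ → Set
Mat n = Fin n → Fin n → ℤ

ΣFin : (n : ℕ) → (Fin n → ℤ) → ℤ
ΣFin zero    f = + 0
ΣFin (suc n) f = f zero ℤ.+ ΣFin n (λ i → f (suc i))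

sgn : ℕ → ℤ
sgn zero          = + 1
sgn (suc zero)    = - + 1
sgn (suc (suc k)) = sgn k

det : (n : ℕ) → Mat n → ℤ
det zero    M = + 1
det (suc n) M =
  ΣFin (suc n) (λ j → sgn (toℕ j) ℤ.* M zero j ℤ.* det n (λ i k → M (suc i) (punchIn j k)))

-- Comaximal graph Γ(ℤ_n): distinct x, y adjacent iff ⟨x⟩ + ⟨y⟩ = ℤ_n,
-- i.e. 1 ∈ ⟨x⟩ + ⟨y⟩, i.e. a·x + b·y ≡ 1 (mod n) for some a, b ∈ ℤ_n.
comaxAdj : (n : ℕ) → Fin n → Fin n → Bool
comaxAdj zero    () y
comaxAdj (suc m) x y =
  not (does (x ≟ y)) ∧
  any (λ a → any (λ b → ((a ℕ.* toℕ x ℕ.+ b ℕ.* toℕ y) % suc m) ≡ᵇ (1 % suc m))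
                 (upTo (suc m)))
      (upTo (suc m))

b2z : Bool → ℤ
b2z true  = + 1
b2z false = + 0

adjM : (n : ℕ) → Mat n
adjM n x y = b2z (comaxAdj n x y)

deg : (n : ℕ) → Fin n → ℤ
deg n x = ΣFin n (adjM n x)

laplacian : (n : ℕ) → Mat n
laplacian n x y = (if does (x ≟ y) then deg n x else + 0) - adjM n x y

charPolyL : (n : ℕ) → ℤ → ℤ
charPolyL n z = det n (λ x y → (if does (x ≟ y) then z else + 0) - laplacian n x y)

-- The comaximality of x and y depends only on whether p and q divide them, so, sorting the vertices of
-- Γ(ℤₙ) into the four kinds "unit", "p-multiple", "q-multiple" and "pq-multiple", the matrix zI - L is
-- diag(μ) plus a matrix whose entry (x, y) depends only on the kinds of x and y, μ being z minus the
-- degree of the kind. Subtracting the row of one vertex from that of another vertex of the same kind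
-- leaves μ(eₓ - e_y), so expanding along it splits off a factor μ and merges the two vertices into one
-- of double weight. Iterating, det(zI - L) is the product of μ^(size - 1) over the kinds times the
-- determinant of the 4×4 quotient matrix, which is z (z - φ(n)) (z - n) (z - n + t) with t = p^(α-1) q^(β-1).
module Submission where

open import Defs
open import Data.Nat using (ℕ; _<_; _≤_; _∸_)
open import Data.Nat.Primality using (Prime)
open import Data.Integer using (ℤ; +_; _-_; _^_)
open import Relation.Binary.PropositionalEquality using (_≡_)
import Data.Nat as N
import Data.Integer as Z

module Determinant where

  open import Data.Nat using (zero; suc; _<_; s≤s)
  open import Data.Integer using (ℤ; +_; -[1+_]; -_; _+_; _*_; _-_)
  open import Data.Integer.Properties using (neg-involutive; neg-distrib-+; *-zeroʳ; *-distribˡ-+; neg-distribʳ-*; +-identityʳ; +-identityˡ)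
  open import Data.Fin using (Fin; zero; suc; toℕ; punchIn; inject₁; lift; _≟_; #_)
  open import Data.Bool using (if_then_else_)
  open import Relation.Nullary using (does)
  open import Data.Product using (Σ; _,_; _×_)
  open import Data.Sum using (_⊎_; inj₁; inj₂)
  open import Function using (_∘_)
  open import Relation.Binary.PropositionalEquality
  open import Data.Integer.Tactic.RingSolver using (solve-∀)

  Σ-cong : ∀ n {f g : Fin n → ℤ} → (∀ i → f i ≡ g i) → ΣFin n f ≡ ΣFin n g
  Σ-cong zero    f≗g = refl
  Σ-cong (suc n) f≗g = cong₂ _+_ (f≗g zero) (Σ-cong n (f≗g ∘ suc))

  Σ-+ : ∀ n (f g : Fin n → ℤ) → ΣFin n (λ i → f i + g i) ≡ ΣFin n f + ΣFin n g
  Σ-+ zero    f g = refl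
  Σ-+ (suc n) f g =
    trans (cong (_+_ (f zero + g zero)) (Σ-+ n (f ∘ suc) (g ∘ suc))) (interchange (f zero) (g zero) _ _)
    where
    interchange : ∀ a b c d → a + b + (c + d) ≡ a + c + (b + d)
    interchange = solve-∀

  Σ-*ˡ : ∀ n c (f : Fin n → ℤ) → ΣFin n (λ i → c * f i) ≡ c * ΣFin n f
  Σ-*ˡ zero    c f = sym (*-zeroʳ c)
  Σ-*ˡ (suc n) c f = trans (cong (_+_ (c * f zero)) (Σ-*ˡ n c (f ∘ suc))) (sym (*-distribˡ-+ c _ _))

  Σ-neg : ∀ n (f : Fin n → ℤ) → ΣFin n (λ i → - f i) ≡ - ΣFin n f
  Σ-neg zero    f = refl
  Σ-neg (suc n) f = trans (cong (_+_ (- f zero)) (Σ-neg n (f ∘ suc))) (sym (neg-distrib-+ (f zero) _))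

  Σ-zero : ∀ n {f : Fin n → ℤ} → (∀ i → f i ≡ + 0) → ΣFin n f ≡ + 0
  Σ-zero zero    f≗0 = refl
  Σ-zero (suc n) f≗0 = cong₂ _+_ (f≗0 zero) (Σ-zero n (f≗0 ∘ suc))

  swapAt : ∀ {n} → Fin n → Fin (suc n) → Fin (suc n)
  swapAt {suc n} zero zero          = suc zero
  swapAt {suc n} zero (suc zero)    = zero
  swapAt {suc n} zero (suc (suc x)) = suc (suc x)
  swapAt (suc i) zero    = zero
  swapAt (suc i) (suc x) = suc (swapAt i x)

  swapAt-involutive : ∀ {n} (i : Fin n) x → swapAt i (swapAt i x) ≡ x
  swapAt-involutive {suc n} zero zero          = refl
  swapAt-involutive {suc n} zero (suc zero)    = refl
  swapAt-involutive {suc n} zero (suc (suc x)) = refl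
  swapAt-involutive (suc i) zero    = refl
  swapAt-involutive (suc i) (suc x) = cong suc (swapAt-involutive i x)

  swapAt-inject₁ : ∀ {n} (i : Fin n) → swapAt i (inject₁ i) ≡ suc i
  swapAt-inject₁ {suc n} zero = refl
  swapAt-inject₁ (suc i)      = cong suc (swapAt-inject₁ i)

  swapAt-fixes : ∀ {n} (i : Fin n) (x : Fin (suc n)) → suc (toℕ i) < toℕ x → swapAt i x ≡ x
  swapAt-fixes {suc n} zero (suc (suc x)) _         = refl
  swapAt-fixes {suc n} zero (suc zero)    (s≤s ())
  swapAt-fixes (suc i)      (suc x)       (s≤s i<x) = cong suc (swapAt-fixes i x i<x)

  Σ-swapAt : ∀ n (i : Fin n) (f : Fin (suc n) → ℤ) → ΣFin (suc n) (f ∘ swapAt i) ≡ ΣFin (suc n) f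
  Σ-swapAt (suc n) zero    f = exchange (f zero) (f (suc zero)) _
    where
    exchange : ∀ a b c → b + (a + c) ≡ a + (b + c)
    exchange = solve-∀
  Σ-swapAt (suc n) (suc i) f = cong (_+_ (f zero)) (Σ-swapAt n i (f ∘ suc))

  sgn-suc : ∀ k → sgn (suc k) ≡ - sgn k
  sgn-suc zero    = refl
  sgn-suc (suc k) = sym (trans (cong -_ (sgn-suc k)) (neg-involutive (sgn k)))

  det-cong : ∀ n {M M' : Mat n} → (∀ i j → M i j ≡ M' i j) → det n M ≡ det n M'
  det-cong zero    M≗M' = refl
  det-cong (suc n) M≗M' = Σ-cong (suc n) λ j →
    cong₂ _*_ (cong (sgn (toℕ j) *_) (M≗M' zero j)) (det-cong n λ i k → M≗M' (suc i) (punchIn j k))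

  minor : ∀ {n} → Mat (suc n) → Fin (suc n) → Mat n
  minor M j i k = M (suc i) (punchIn j k)

  Extensional : ∀ {n m} → ((Fin n → Fin m) → ℤ) → Set
  Extensional g = ∀ {h h'} → (∀ l → h l ≡ h' l) → g h ≡ g h'

  -- g h is the determinant of the rows below u and v on the columns picked by h, so that
  -- det (2+n) M unfolds to expand₂ n (M 0) (M 1) (λ h → det n λ i l → M (2+i) (h l)).
  expand₂ : ∀ n (u v : Fin (suc (suc n)) → ℤ) → ((Fin n → Fin (suc (suc n))) → ℤ) → ℤ
  expand₂ n u v g = ΣFin (suc (suc n)) λ j → sgn (toℕ j) * u j *
    ΣFin (suc n) λ k → sgn (toℕ k) * v (punchIn j k) * g (punchIn j ∘ punchIn k)

  expand₁ : ∀ n (v : Fin (suc (suc n)) → ℤ) → ((Fin n → Fin (suc (suc n))) → ℤ) → ℤ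
  expand₁ n v g = ΣFin (suc n) λ k → sgn (toℕ k) * v (suc k) * g (suc ∘ punchIn k)

  expand₂-tail : ∀ n (u v : Fin (suc (suc n)) → ℤ) → ((Fin n → Fin (suc (suc n))) → ℤ) → ℤ
  expand₂-tail n u v g = ΣFin (suc n) λ j → sgn (toℕ j) * u (suc j) *
    ΣFin n λ k → sgn (toℕ k) * v (suc (punchIn j k)) * g (punchIn (suc j) ∘ punchIn (suc k))

  expand₂-split : ∀ n u v g →
    expand₂ n u v g ≡ + 1 * u zero * expand₁ n v g + (- (v zero * expand₁ n u g) + expand₂-tail n u v g)
  expand₂-split n u v g = cong (_+_ (+ 1 * u zero * expand₁ n v g)) (begin
      ΣFin (suc n) (λ j → sgn (toℕ (suc j)) * u (suc j) * inner j)
    ≡⟨ Σ-cong (suc n) term ⟩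
      ΣFin (suc n) (λ j → - (v zero * F j) + sgn (toℕ j) * u (suc j) * rest j)
    ≡⟨ Σ-+ (suc n) (λ j → - (v zero * F j)) (λ j → sgn (toℕ j) * u (suc j) * rest j) ⟩
      ΣFin (suc n) (λ j → - (v zero * F j)) + expand₂-tail n u v g
    ≡⟨ cong (_+ expand₂-tail n u v g) (trans (Σ-neg (suc n) (λ j → v zero * F j)) (cong -_ (Σ-*ˡ (suc n) (v zero) F))) ⟩
      - (v zero * expand₁ n u g) + expand₂-tail n u v g ∎)
    where
    open ≡-Reasoning
    inner : Fin (suc n) → ℤ
    inner j = ΣFin (suc n) λ k → sgn (toℕ k) * v (punchIn (suc j) k) * g (punchIn (suc j) ∘ punchIn k)
    F rest : Fin (suc n) → ℤ
    F j = sgn (toℕ j) * u (suc j) * g (suc ∘ punchIn j)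
    rest j = ΣFin n λ k → sgn (toℕ k) * v (suc (punchIn j k)) * g (punchIn (suc j) ∘ punchIn (suc k))
    shifted-sign : ∀ j → ΣFin n (λ k → sgn (toℕ (suc k)) * v (suc (punchIn j k)) * g (punchIn (suc j) ∘ punchIn (suc k)))
                         ≡ - rest j
    shifted-sign j = trans (Σ-cong n λ k → let V = v (suc (punchIn j k)); G = g (punchIn (suc j) ∘ punchIn (suc k)) in
                             trans (cong (λ s → s * V * G) (sgn-suc (toℕ k))) (neg-*-* (sgn (toℕ k)) V G))
                           (Σ-neg n λ k → sgn (toℕ k) * v (suc (punchIn j k)) * g (punchIn (suc j) ∘ punchIn (suc k)))
      where
      neg-*-* : ∀ s a b → (- s) * a * b ≡ - (s * a * b)
      neg-*-* = solve-∀
    term : ∀ j → sgn (toℕ (suc j)) * u (suc j) * inner j ≡ - (v zero * F j) + sgn (toℕ j) * u (suc j) * rest j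
    term j = trans (cong₂ (λ s r → s * u (suc j) * (+ 1 * v zero * g (suc ∘ punchIn j) + r)) (sgn-suc (toℕ j)) (shifted-sign j))
                   (distribute (sgn (toℕ j)) (u (suc j)) (v zero) _ (rest j))
      where
      distribute : ∀ s a b G R → (- s) * a * (+ 1 * b * G + - R) ≡ - (b * (s * a * G)) + s * a * R
      distribute = solve-∀

  expand₂-tail-antisym : ∀ n u v g → Extensional g → expand₂-tail n u v g ≡ - expand₂-tail n v u g
  expand₂-antisym : ∀ n u v g → Extensional g → expand₂ n u v g ≡ - expand₂ n v u g

  expand₂-tail-antisym zero u v g _ = zeros (sgn 0 * u (suc zero)) (sgn 0 * v (suc zero))
    where
    zeros : ∀ a b → a * + 0 + + 0 ≡ - (b * + 0 + + 0)
    zeros = solve-∀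
  expand₂-tail-antisym (suc n) u v g g-ext =
    trans (as-expand₂ u v) (trans (expand₂-antisym n (u ∘ suc) (v ∘ suc) (g ∘ lift 1) (g-ext ∘ lift-cong))
                                  (cong -_ (sym (as-expand₂ v u))))
    where
    lift-cong : ∀ {h h' : Fin n → Fin (suc (suc n))} → (∀ l → h l ≡ h' l) → ∀ l → lift 1 h l ≡ lift 1 h' l
    lift-cong h≗h' zero    = refl
    lift-cong h≗h' (suc l) = cong suc (h≗h' l)
    lift-punchIn : ∀ j k l → punchIn (suc j) (punchIn (suc k) l) ≡ lift 1 (punchIn j ∘ punchIn k) l
    lift-punchIn j k zero    = refl
    lift-punchIn j k (suc l) = refl
    as-expand₂ : ∀ u v → expand₂-tail (suc n) u v g ≡ expand₂ n (u ∘ suc) (v ∘ suc) (g ∘ lift 1)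
    as-expand₂ u v = Σ-cong (suc (suc n)) λ j → cong (sgn (toℕ j) * u (suc j) *_)
      (Σ-cong (suc n) λ k → cong (sgn (toℕ k) * v (suc (punchIn j k)) *_) (g-ext (lift-punchIn j k)))

  expand₂-antisym n u v g g-ext =
    trans (expand₂-split n u v g)
    (trans (cong (λ t → + 1 * u zero * expand₁ n v g + (- (v zero * expand₁ n u g) + t)) (expand₂-tail-antisym n u v g g-ext))
    (trans (reorder (u zero) (expand₁ n v g) (v zero) (expand₁ n u g) (expand₂-tail n v u g))
           (cong -_ (sym (expand₂-split n v u g)))))
    where
    reorder : ∀ a b c d t → + 1 * a * b + (- (c * d) + - t) ≡ - (+ 1 * c * d + (- (a * b) + t))
    reorder = solve-∀

  det-swapRows : ∀ n (i : Fin n) (M : Mat (suc n)) → det (suc n) (λ x y → M (swapAt i x) y) ≡ - det (suc n) M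
  det-swapRows (suc n) zero M =
    expand₂-antisym n (M (suc zero)) (M zero) (λ h → det n λ i l → M (suc (suc i)) (h l))
                    (λ h≗h' → det-cong n λ i l → cong (M (suc (suc i))) (h≗h' l))
  det-swapRows (suc n) (suc i) M =
    trans (Σ-cong (suc (suc n)) λ j → trans (cong (sgn (toℕ j) * M zero j *_) (det-swapRows n i (minor M j)))
                                             (sym (neg-distribʳ-* (sgn (toℕ j) * M zero j) _)))
          (Σ-neg (suc (suc n)) λ j → sgn (toℕ j) * M zero j * det (suc n) (minor M j))

  -- Deleting column j after the column swap at i is deleting column (swapAt i j), possibly followed by
  -- a column swap inside the minor; the sign of the cofactor flips exactly when there is no inner swap.
  PunchInSwap : ∀ {m} → Fin (suc m) → Fin (suc (suc m)) → Set
  PunchInSwap {m} i j =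
      ((∀ l → swapAt i (punchIn j l) ≡ punchIn (swapAt i j) l) × sgn (toℕ (swapAt i j)) ≡ - sgn (toℕ j))
    ⊎ Σ (Fin m) λ i' → (∀ l → swapAt i (punchIn j l) ≡ punchIn (swapAt i j) (swapAt i' l))
                       × sgn (toℕ (swapAt i j)) ≡ sgn (toℕ j)

  punchIn-swapAt : ∀ {m} (i : Fin (suc m)) (j : Fin (suc (suc m))) → PunchInSwap i j
  punchIn-swapAt zero zero = inj₁ ((λ { zero → refl ; (suc l) → refl }) , refl)
  punchIn-swapAt zero (suc zero) = inj₁ ((λ { zero → refl ; (suc l) → refl }) , refl)
  punchIn-swapAt {suc m} zero (suc (suc j)) =
    inj₂ (zero , (λ { zero → refl ; (suc zero) → refl ; (suc (suc l)) → refl }) , refl)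
  punchIn-swapAt (suc i) zero = inj₂ (i , (λ l → refl) , refl)
  punchIn-swapAt {suc m} (suc i) (suc j) with punchIn-swapAt i j
  ... | inj₁ (commutes , flips) =
    inj₁ ((λ { zero → refl ; (suc l) → cong suc (commutes l) })
         , trans (sgn-suc (toℕ (swapAt i j))) (trans (cong -_ flips) (cong -_ (sym (sgn-suc (toℕ j))))))
  ... | inj₂ (i' , commutes , keeps) =
    inj₂ (suc i' , (λ { zero → refl ; (suc l) → cong suc (commutes l) })
         , trans (sgn-suc (toℕ (swapAt i j))) (trans (cong -_ keeps) (sym (sgn-suc (toℕ j)))))

  det-swapCols : ∀ n (i : Fin n) (M : Mat (suc n)) → det (suc n) (λ x y → M x (swapAt i y)) ≡ - det (suc n) M
  det-swapCols (suc m) i M =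
    trans (Σ-cong (suc (suc m)) cofactor)
          (trans (Σ-neg (suc (suc m)) (C ∘ swapAt i)) (cong -_ (Σ-swapAt (suc m) i C)))
    where
    C : Fin (suc (suc m)) → ℤ
    C j = sgn (toℕ j) * M zero j * det (suc m) (minor M j)
    negˡ : ∀ s a d → (- s) * a * d ≡ - (s * a * d)
    negˡ = solve-∀
    negʳ : ∀ s a d → s * a * (- d) ≡ - (s * a * d)
    negʳ = solve-∀
    cofactor : ∀ j → sgn (toℕ j) * M zero (swapAt i j) * det (suc m) (λ r k → M (suc r) (swapAt i (punchIn j k)))
                   ≡ - C (swapAt i j)
    cofactor j with punchIn-swapAt i j
    ... | inj₁ (commutes , flips) =
      trans (cong₂ (λ s d → s * M zero (swapAt i j) * d)
                   (trans (sym (neg-involutive _)) (cong -_ (sym flips)))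
                   (det-cong (suc m) λ r k → cong (M (suc r)) (commutes k)))
            (negˡ (sgn (toℕ (swapAt i j))) _ _)
    ... | inj₂ (i' , commutes , keeps) =
      trans (cong₂ (λ s d → s * M zero (swapAt i j) * d) (sym keeps)
                   (trans (det-cong (suc m) λ r k → cong (M (suc r)) (commutes k))
                          (det-swapCols m i' (minor M (swapAt i j)))))
            (negʳ (sgn (toℕ (swapAt i j))) _ _)

  det-swapBoth : ∀ n (i : Fin n) (M : Mat (suc n)) → det (suc n) (λ x y → M (swapAt i x) (swapAt i y)) ≡ det (suc n) M
  det-swapBoth n i M = trans (det-swapRows n i (λ x y → M x (swapAt i y)))
                             (trans (cong -_ (det-swapCols n i M)) (neg-involutive _))

  private
    self-negating : ∀ x → x ≡ - x → x ≡ + 0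
    self-negating (+ zero)  _ = refl
    self-negating (+ suc n) ()
    self-negating -[1+ n ]  ()

  det-equalRows₀₁ : ∀ n (M : Mat (suc (suc n))) → (∀ y → M zero y ≡ M (suc zero) y) → det (suc (suc n)) M ≡ + 0
  det-equalRows₀₁ n M rows≡ = self-negating _ (trans (sym (det-cong (suc (suc n)) unchanged)) (det-swapRows (suc n) zero M))
    where
    unchanged : ∀ x y → M (swapAt zero x) y ≡ M x y
    unchanged zero          y = sym (rows≡ y)
    unchanged (suc zero)    y = rows≡ y
    unchanged (suc (suc x)) y = refl

  -- Subtracting row 1 from row 0 leaves a·(e₀ - e₁), whose cofactor expansion has only two terms.
  det-rowDifference : ∀ n (M : Mat (suc (suc n))) a →
    M zero zero ≡ M (suc zero) zero + a → M zero (suc zero) ≡ M (suc zero) (suc zero) - a →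
    (∀ j → M zero (suc (suc j)) ≡ M (suc zero) (suc (suc j))) →
    det (suc (suc n)) M ≡ a * (det (suc n) (minor M zero) + det (suc n) (minor M (suc zero)))
  det-rowDifference n M a at₀ at₁ elsewhere = begin
      det (suc (suc n)) M
    ≡⟨ Σ-cong (suc (suc n)) split ⟩
      ΣFin (suc (suc n)) (λ j → sgn (toℕ j) * M (suc zero) j * D j + sgn (toℕ j) * R j * D j)
    ≡⟨ Σ-+ (suc (suc n)) (λ j → sgn (toℕ j) * M (suc zero) j * D j) (λ j → sgn (toℕ j) * R j * D j) ⟩
      det (suc (suc n)) M' + ΣFin (suc (suc n)) (λ j → sgn (toℕ j) * R j * D j)
    ≡⟨ cong₂ _+_ (det-equalRows₀₁ n M' (λ y → refl))
                 (cong (_+_ (+ 1 * a * D zero)) (cong (_+_ (- (+ 1) * (- a) * D (suc zero)))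
                       (Σ-zero n λ j → zero-term (sgn (toℕ j)) (D (suc (suc j)))))) ⟩
      + 0 + (+ 1 * a * D zero + (- (+ 1) * (- a) * D (suc zero) + + 0))
    ≡⟨ collect a (D zero) (D (suc zero)) ⟩
      a * (D zero + D (suc zero)) ∎
    where
    open ≡-Reasoning
    D : Fin (suc (suc n)) → ℤ
    D j = det (suc n) (minor M j)
    M' : Mat (suc (suc n))
    M' zero    = M (suc zero)
    M' (suc x) = M (suc x)
    R : Fin (suc (suc n)) → ℤ
    R zero          = a
    R (suc zero)    = - a
    R (suc (suc j)) = + 0
    row₀ : ∀ j → M zero j ≡ M (suc zero) j + R j
    row₀ zero          = at₀
    row₀ (suc zero)    = at₁
    row₀ (suc (suc j)) = trans (elsewhere j) (sym (+-identityʳ _))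
    split : ∀ j → sgn (toℕ j) * M zero j * D j ≡ sgn (toℕ j) * M (suc zero) j * D j + sgn (toℕ j) * R j * D j
    split j = trans (cong (λ m → sgn (toℕ j) * m * D j) (row₀ j)) (distrib (sgn (toℕ j)) _ (R j) (D j))
      where
      distrib : ∀ s m r d → s * (m + r) * d ≡ s * m * d + s * r * d
      distrib = solve-∀
    zero-term : ∀ s d → s * + 0 * d ≡ + 0
    zero-term = solve-∀
    collect : ∀ a d₀ d₁ → + 0 + (+ 1 * a * d₀ + (- (+ 1) * (- a) * d₁ + + 0)) ≡ a * (d₀ + d₁)
    collect = solve-∀

  det-linear-col₀ : ∀ n (A B C : Mat (suc n)) →
    (∀ x → C x zero ≡ A x zero + B x zero) →
    (∀ x y → C x (suc y) ≡ A x (suc y)) → (∀ x y → C x (suc y) ≡ B x (suc y)) →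
    det (suc n) C ≡ det (suc n) A + det (suc n) B
  det-linear-col₀ zero A B C col₀ _ _ = trans (cong (λ c → + 1 * c * + 1 + + 0) (col₀ zero)) (linear (A zero zero) (B zero zero))
    where
    linear : ∀ a b → + 1 * (a + b) * + 1 + + 0 ≡ + 1 * a * + 1 + + 0 + (+ 1 * b * + 1 + + 0)
    linear = solve-∀
  det-linear-col₀ (suc n) A B C col₀ C≡A C≡B = begin
      det (suc (suc n)) C
    ≡⟨ cong₂ _+_ (cong₂ (λ c d → + 1 * c * d) (col₀ zero) (det-cong (suc n) λ i k → C≡A (suc i) k))
                 (Σ-cong (suc n) λ j → cong₂ _*_ (cong (sgn (toℕ (suc j)) *_) (C≡A zero j)) (IH j)) ⟩
      + 1 * (A zero zero + B zero zero) * D₀ + ΣFin (suc n) (λ j → c j * (DA j + DB j))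
    ≡⟨ cong (_+_ (+ 1 * (A zero zero + B zero zero) * D₀)) (trans (Σ-cong (suc n) λ j → *-distribˡ-+ (c j) (DA j) (DB j))
                                                                   (Σ-+ (suc n) (λ j → c j * DA j) (λ j → c j * DB j))) ⟩
      + 1 * (A zero zero + B zero zero) * D₀ + (ΣFin (suc n) (λ j → c j * DA j) + ΣFin (suc n) (λ j → c j * DB j))
    ≡⟨ regroup (A zero zero) (B zero zero) D₀ (ΣFin (suc n) (λ j → c j * DA j)) (ΣFin (suc n) (λ j → c j * DB j)) ⟩
      (+ 1 * A zero zero * D₀ + ΣFin (suc n) (λ j → c j * DA j)) + (+ 1 * B zero zero * D₀ + ΣFin (suc n) (λ j → c j * DB j))
    ≡⟨ cong (_+_ (det (suc (suc n)) A)) (cong₂ _+_ (cong (+ 1 * B zero zero *_) (det-cong (suc n) λ i k → trans (sym (C≡A (suc i) k)) (C≡B (suc i) k)))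
                                 (Σ-cong (suc n) λ j → cong (λ b → sgn (toℕ (suc j)) * b * DB j) (trans (sym (C≡A zero j)) (C≡B zero j)))) ⟩
      det (suc (suc n)) A + det (suc (suc n)) B ∎
    where
    open ≡-Reasoning
    D₀ : ℤ
    D₀ = det (suc n) (minor A zero)
    c DA DB : Fin (suc n) → ℤ
    c j = sgn (toℕ (suc j)) * A zero (suc j)
    DA j = det (suc n) (minor A (suc j))
    DB j = det (suc n) (minor B (suc j))
    IH : ∀ j → det (suc n) (minor C (suc j)) ≡ DA j + DB j
    IH j = det-linear-col₀ n (minor A (suc j)) (minor B (suc j)) (minor C (suc j))
             (λ x → col₀ (suc x)) (λ x y → C≡A (suc x) (punchIn j y)) (λ x y → C≡B (suc x) (punchIn j y))
    regroup : ∀ a b d s t → + 1 * (a + b) * d + (s + t) ≡ (+ 1 * a * d + s) + (+ 1 * b * d + t)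
    regroup = solve-∀

  Σ-indicator : ∀ n (j : Fin n) (f : Fin n → ℤ) → ΣFin n (λ x → if does (x ≟ j) then f x else + 0) ≡ f j
  Σ-indicator (suc n) zero    f = trans (cong (_+_ (f zero)) (Σ-zero n λ _ → refl)) (+-identityʳ (f zero))
  Σ-indicator (suc n) (suc j) f = trans (+-identityˡ _) (Σ-indicator n j (f ∘ suc))

  Σ-skip : ∀ n (x : Fin n) (g : Fin n → ℤ) → ΣFin n (λ y → if does (x ≟ y) then + 0 else g y) ≡ ΣFin n g - g x
  Σ-skip (suc n) zero    g = drop (g zero) (ΣFin n (g ∘ suc))
    where
    drop : ∀ a s → + 0 + s ≡ a + s - a
    drop = solve-∀
  Σ-skip (suc n) (suc x) g = trans (cong (_+_ (g zero)) (Σ-skip n x (g ∘ suc))) (reassociate (g zero) _ (g (suc x)))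
    where
    reassociate : ∀ a s b → a + (s - b) ≡ a + s - b
    reassociate = solve-∀

  det₂ : ℤ → ℤ → ℤ → ℤ → ℤ
  det₂ a b c d = a * d - b * c

  det₃ : ℤ → ℤ → ℤ → ℤ → ℤ → ℤ → ℤ → ℤ → ℤ → ℤ
  det₃ a b c d e f g h i = a * det₂ e f h i - b * det₂ d f g i + c * det₂ d e g h

  det₄ : ℤ → ℤ → ℤ → ℤ → ℤ → ℤ → ℤ → ℤ → ℤ → ℤ → ℤ → ℤ → ℤ → ℤ → ℤ → ℤ → ℤ
  det₄ a b c d e f g h i j k l m n o p =
    a * det₃ f g h j k l n o p - b * det₃ e g h i k l m o p + c * det₃ e f h i j l m n p - d * det₃ e f g i j k m n o

  det-2 : ∀ (M : Mat 2) → det 2 M ≡ det₂ (M (# 0) (# 0)) (M (# 0) (# 1)) (M (# 1) (# 0)) (M (# 1) (# 1))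
  det-2 M = expansion (M (# 0) (# 0)) (M (# 0) (# 1)) (M (# 1) (# 0)) (M (# 1) (# 1))
    where
    expansion : ∀ a b c d → + 1 * a * (+ 1 * d * + 1 + + 0) + (- + 1 * b * (+ 1 * c * + 1 + + 0) + + 0) ≡ a * d - b * c
    expansion = solve-∀

  det-3 : ∀ (M : Mat 3) → det 3 M ≡ det₃ (M (# 0) (# 0)) (M (# 0) (# 1)) (M (# 0) (# 2))
                                           (M (# 1) (# 0)) (M (# 1) (# 1)) (M (# 1) (# 2))
                                           (M (# 2) (# 0)) (M (# 2) (# 1)) (M (# 2) (# 2))
  det-3 M = trans (Σ-cong 3 λ j → cong (sgn (toℕ j) * M zero j *_) (det-2 (minor M j)))
                  (cofactors (M (# 0) (# 0)) (M (# 0) (# 1)) (M (# 0) (# 2)) _ _ _)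
    where
    cofactors : ∀ a b c D₀ D₁ D₂ → + 1 * a * D₀ + (- + 1 * b * D₁ + (+ 1 * c * D₂ + + 0)) ≡ a * D₀ - b * D₁ + c * D₂
    cofactors = solve-∀

  det-4 : ∀ (M : Mat 4) → det 4 M ≡ det₄ (M (# 0) (# 0)) (M (# 0) (# 1)) (M (# 0) (# 2)) (M (# 0) (# 3))
                                           (M (# 1) (# 0)) (M (# 1) (# 1)) (M (# 1) (# 2)) (M (# 1) (# 3))
                                           (M (# 2) (# 0)) (M (# 2) (# 1)) (M (# 2) (# 2)) (M (# 2) (# 3))
                                           (M (# 3) (# 0)) (M (# 3) (# 1)) (M (# 3) (# 2)) (M (# 3) (# 3))
  det-4 M = trans (Σ-cong 4 λ j → cong (sgn (toℕ j) * M zero j *_) (det-3 (minor M j)))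
                  (cofactors (M (# 0) (# 0)) (M (# 0) (# 1)) (M (# 0) (# 2)) (M (# 0) (# 3)) _ _ _ _)
    where
    cofactors : ∀ a b c d D₀ D₁ D₂ D₃ →
      + 1 * a * D₀ + (- + 1 * b * D₁ + (+ 1 * c * D₂ + (- + 1 * d * D₃ + + 0))) ≡ a * D₀ - b * D₁ + c * D₂ - d * D₃
    cofactors = solve-∀

module Kinds where

  open Determinant
  open import Data.Nat as ℕ using (ℕ; zero; suc; _≤_; _<_; _∸_; s≤s; z≤n; _<ᵇ_; _≤?_)
  import Data.Nat.Properties as ℕₚ
  open import Data.Integer using (ℤ; +_; _+_; _*_; _-_; _^_)
  open import Data.Integer.Properties using (*-assoc)
  open import Data.Bool using (Bool; true; false; if_then_else_)
  import Data.Bool.Properties as Boolₚ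
  open import Data.Product using (_×_; _,_)
  open import Data.Product.Properties using (≡-dec)
  open import Data.Fin using (Fin; zero; suc; toℕ; inject₁; _≟_)
  open import Data.Fin.Properties using (pigeonhole; toℕ-inject₁; all?)
  import Data.Nat.Tactic.RingSolver as ℕ-Solver
  open import Data.Fin.Induction using (<-weakInduction)
  open import Data.List as List using (List)
  open import Data.Vec.Functional using ([]; _∷_)
  open import Data.Integer.Properties using (+-identityˡ; *-identityˡ; pos-+)
  open import Function using (_∘_; id; mk⇔)
  open import Relation.Nullary using (Dec; yes; no; does)
  open import Relation.Nullary.Decidable using (does-⇔; dec-true; toWitness; _→-dec_; map′)
  open import Relation.Binary.Definitions using (DecidableEquality)
  open import Relation.Binary.PropositionalEquality
  open import Data.Integer.Tactic.RingSolver using (solve-∀)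
  open import Algebra.Properties.CommutativeMonoid.Sum ℕₚ.+-0-commutativeMonoid using (sum; sum-permute; sum-cong-≗)
  open import Data.Fin.Permutation using (permutation)

  Kind : Set
  Kind = Bool × Bool

  _≟ₖ_ : DecidableEquality Kind
  _≟ₖ_ = ≡-dec Boolₚ._≟_ Boolₚ._≟_

  enumKind : Fin 4 → Kind
  enumKind = (false , false) ∷ (true , false) ∷ (false , true) ∷ (true , true) ∷ []

  indexKind : Kind → Fin 4
  indexKind (false , false) = zero
  indexKind (true  , false) = suc zero
  indexKind (false , true)  = suc (suc zero)
  indexKind (true  , true)  = suc (suc (suc zero))

  enumKind-indexKind : ∀ a → enumKind (indexKind a) ≡ a
  enumKind-indexKind (false , false) = refl
  enumKind-indexKind (true  , false) = refl
  enumKind-indexKind (false , true)  = refl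
  enumKind-indexKind (true  , true)  = refl

  indexKind-enumKind : ∀ i → indexKind (enumKind i) ≡ i
  indexKind-enumKind zero                   = refl
  indexKind-enumKind (suc zero)             = refl
  indexKind-enumKind (suc (suc zero))       = refl
  indexKind-enumKind (suc (suc (suc zero))) = refl

  ∀-Kind? : {P : Kind → Set} → (∀ a → Dec (P a)) → Dec (∀ a → P a)
  ∀-Kind? {P} P? = map′ (λ ∀i a → subst P (enumKind-indexKind a) (∀i (indexKind a))) (λ ∀a i → ∀a (enumKind i))
                        (all? (P? ∘ enumKind))

  ΠKind : (Kind → ℤ) → ℤ
  ΠKind f = f (false , false) * f (true , false) * f (false , true) * f (true , true)

  δ : Kind → Kind → ℕ
  δ a l = if does (a ≟ₖ l) then 1 else 0

  count : ∀ n → (Fin n → Kind) → Kind → ℕ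
  count n k l = sum λ x → δ (k x) l

  weight : ∀ n → (Fin n → Kind) → (Fin n → ℤ) → Kind → ℤ
  weight n k w l = ΣFin n λ x → if does (k x ≟ₖ l) then w x else + 0

  count-swapAt : ∀ n (r : Fin n) k l → count (suc n) (k ∘ swapAt r) l ≡ count (suc n) k l
  count-swapAt n r k l =
    sym (sum-permute (λ x → δ (k x) l) (permutation (swapAt r) (swapAt r) (swapAt-involutive r) (swapAt-involutive r)))

  weight-swapAt : ∀ n (r : Fin n) k w l → weight (suc n) (k ∘ swapAt r) (w ∘ swapAt r) l ≡ weight (suc n) k w l
  weight-swapAt n r k w l = Σ-swapAt n r λ x → if does (k x ≟ₖ l) then w x else + 0

  -- Bubble the two rows to the front by adjacent transpositions.
  module _ {A B : Set} {n : ℕ} (P : (Fin (suc (suc n)) → A) → (Fin (suc (suc n)) → B) → Set)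
           (P-swapAt : ∀ r k w → P (k ∘ swapAt r) (w ∘ swapAt r) → P k w)
           (P-front : ∀ k w → k zero ≡ k (suc zero) → P k w) where

    private
      partner-to-second : ∀ y k w → k zero ≡ k (suc y) → P k w
      partner-to-second = <-weakInduction (λ y → ∀ k w → k zero ≡ k (suc y) → P k w) P-front step
        where
        step : ∀ i → (∀ k w → k zero ≡ k (suc (inject₁ i)) → P k w) → ∀ k w → k zero ≡ k (suc (suc i)) → P k w
        step i IH k w same = P-swapAt (suc i) k w (IH (k ∘ swapAt (suc i)) (w ∘ swapAt (suc i))
                               (trans same (cong (k ∘ suc) (sym (swapAt-inject₁ i)))))

    sameLabel-to-front : ∀ x y k w → toℕ x < toℕ y → k x ≡ k y → P k w
    sameLabel-to-front = <-weakInduction (λ x → ∀ y k w → toℕ x < toℕ y → k x ≡ k y → P k w) base step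
      where
      base : ∀ y k w → 0 < toℕ y → k zero ≡ k y → P k w
      base (suc y) k w _ same = partner-to-second y k w same
      step : ∀ i → (∀ y k w → toℕ (inject₁ i) < toℕ y → k (inject₁ i) ≡ k y → P k w) →
             ∀ y k w → suc (toℕ i) < toℕ y → k (suc i) ≡ k y → P k w
      step i IH y k w i<y same = P-swapAt i k w (IH y (k ∘ swapAt i) (w ∘ swapAt i)
        (subst (_< toℕ y) (sym (toℕ-inject₁ i)) (ℕₚ.<-trans (ℕₚ.n<1+n (toℕ i)) i<y))
        (trans (cong k (swapAt-inject₁ i)) (trans same (cong k (sym (swapAt-fixes i y i<y))))))

  swapIf : Bool → Fin 3 → Fin 4 → Fin 4
  swapIf true  r = swapAt r
  swapIf false r = id

  compareSwap : Fin 3 → (Fin 4 → Kind) → Fin 4 → Fin 4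
  compareSwap r k = swapIf (toℕ (indexKind (k (suc r))) <ᵇ toℕ (indexKind (k (inject₁ r)))) r

  bubbleSort : List (Fin 3) → (Fin 4 → Kind) → Fin 4 → Fin 4
  bubbleSort List.[]         k = id
  bubbleSort (r List.∷ rs) k = compareSwap r k ∘ bubbleSort rs (k ∘ compareSwap r k)

  bubbleNetwork : List (Fin 3)
  bubbleNetwork = zero List.∷ suc zero List.∷ suc (suc zero) List.∷ zero List.∷ suc zero List.∷ zero List.∷ List.[]

  -- Checked by evaluating all 4⁴ labellings.
  bubbleSort-enumKind : ∀ a b c d → let k = a ∷ b ∷ c ∷ d ∷ [] in
    (∀ l → 1 ≤ count 4 k l) → ∀ x → k (bubbleSort bubbleNetwork k x) ≡ enumKind x
  bubbleSort-enumKind = toWitness {a? = ∀-Kind? λ a → ∀-Kind? λ b → ∀-Kind? λ c → ∀-Kind? λ d →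
    let k = a ∷ b ∷ c ∷ d ∷ [] in
    (∀-Kind? λ l → 1 ≤? count 4 k l) →-dec all? λ x → k (bubbleSort bubbleNetwork k x) ≟ₖ enumKind x} _

  module _ {B : Set} (P : (Fin 4 → Kind) → (Fin 4 → B) → Set)
           (P-swapAt : ∀ r k w → P (k ∘ swapAt r) (w ∘ swapAt r) → P k w) where

    bubbleSort-reflects : ∀ rs k w → P (k ∘ bubbleSort rs k) (w ∘ bubbleSort rs k) → P k w
    bubbleSort-reflects List.[]         k w p = p
    bubbleSort-reflects (r List.∷ rs) k w p =
      swapIf-reflects (toℕ (indexKind (k (suc r))) <ᵇ toℕ (indexKind (k (inject₁ r))))
        (bubbleSort-reflects rs (k ∘ compareSwap r k) (w ∘ compareSwap r k) p)
      where
      swapIf-reflects : ∀ b → P (k ∘ swapIf b r) (w ∘ swapIf b r) → P k w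
      swapIf-reflects true  = P-swapAt r k w
      swapIf-reflects false = id

  byKind : {A : Set} → A → A → A → A → Kind → A
  byKind u _ _ _ (false , false) = u
  byKind _ p _ _ (true  , false) = p
  byKind _ _ q _ (false , true)  = q
  byKind _ _ _ r (true  , true)  = r

  ΣKind : (Kind → ℤ) → ℤ
  ΣKind f = f (false , false) + f (true , false) + f (false , true) + f (true , true)

  Σ-byKind : ∀ n (k : Fin n → Kind) (f : Kind → ℤ) w → ΣFin n (λ y → f (k y) * w y) ≡ ΣKind (λ l → f l * weight n k w l)
  Σ-byKind zero    k f w = sym (zeros (f (false , false)) (f (true , false)) (f (false , true)) (f (true , true)))
    where
    zeros : ∀ a b c d → a * + 0 + b * + 0 + c * + 0 + d * + 0 ≡ + 0
    zeros = solve-∀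
  Σ-byKind (suc n) k f w = trans (cong₂ _+_ (single (k zero) (w zero)) (Σ-byKind n (k ∘ suc) f (w ∘ suc)))
                                 (collect (f (false , false)) (f (true , false)) (f (false , true)) (f (true , true)) _ _ _ _ _ _ _ _)
    where
    collect : ∀ a b c d x₁ x₂ x₃ x₄ y₁ y₂ y₃ y₄ →
      (a * x₁ + b * x₂ + c * x₃ + d * x₄) + (a * y₁ + b * y₂ + c * y₃ + d * y₄)
      ≡ a * (x₁ + y₁) + b * (x₂ + y₂) + c * (x₃ + y₃) + d * (x₄ + y₄)
    collect = solve-∀
    only₁ : ∀ a b c d v → a * v ≡ a * v + b * + 0 + c * + 0 + d * + 0
    only₁ = solve-∀
    only₂ : ∀ a b c d v → b * v ≡ a * + 0 + b * v + c * + 0 + d * + 0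
    only₂ = solve-∀
    only₃ : ∀ a b c d v → c * v ≡ a * + 0 + b * + 0 + c * v + d * + 0
    only₃ = solve-∀
    only₄ : ∀ a b c d v → d * v ≡ a * + 0 + b * + 0 + c * + 0 + d * v
    only₄ = solve-∀
    single : ∀ a v → f a * v ≡ ΣKind (λ l → f l * (if does (a ≟ₖ l) then v else + 0))
    single (false , false) = only₁ (f (false , false)) (f (true , false)) (f (false , true)) (f (true , true))
    single (true  , false) = only₂ (f (false , false)) (f (true , false)) (f (false , true)) (f (true , true))
    single (false , true)  = only₃ (f (false , false)) (f (true , false)) (f (false , true)) (f (true , true))
    single (true  , true)  = only₄ (f (false , false)) (f (true , false)) (f (false , true)) (f (true , true))

  ΠKind-cong : ∀ {f g : Kind → ℤ} → (∀ l → f l ≡ g l) → ΠKind f ≡ ΠKind g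
  ΠKind-cong f≗g = cong₂ _*_ (cong₂ _*_ (cong₂ _*_ (f≗g _) (f≗g _)) (f≗g _)) (f≗g _)

  ΣKind-cong : ∀ {f g : Kind → ℤ} → (∀ l → f l ≡ g l) → ΣKind f ≡ ΣKind g
  ΣKind-cong f≗g = cong₂ _+_ (cong₂ _+_ (cong₂ _+_ (f≗g _) (f≗g _)) (f≗g _)) (f≗g _)

  merge : ∀ {n} → (Fin (suc (suc n)) → ℤ) → Fin (suc n) → ℤ
  merge w zero    = w (suc zero) + w zero
  merge w (suc y) = w (suc (suc y))

  weight-merge : ∀ n (k : Fin (suc n) → Kind) w l → weight (suc (suc n)) (k zero ∷ k) w l ≡ weight (suc n) k (merge w) l
  weight-merge n k w l with does (k zero ≟ₖ l)
  ... | true  = regroup (w zero) (w (suc zero)) _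
    where
    regroup : ∀ a b r → a + (b + r) ≡ b + a + r
    regroup = solve-∀
  ... | false = +-identityˡ _

  count-witness : ∀ n (k : Fin n → Kind) y → 1 ≤ count n k (k y)
  count-witness (suc n) k zero    = subst (λ b → 1 ≤ (if b then 1 else 0) ℕ.+ count n (k ∘ suc) (k zero))
                                          (sym (dec-true (k zero ≟ₖ k zero) refl)) (s≤s z≤n)
  count-witness (suc n) k (suc y) = ℕₚ.≤-trans (count-witness n (k ∘ suc) y) (ℕₚ.m≤n+m _ (δ (k zero) (k (suc y))))

  weight-ones : ∀ n k l → weight n k (λ _ → + 1) l ≡ + count n k l
  weight-ones zero    k l = refl
  weight-ones (suc n) k l = trans (cong₂ _+_ (indicator (does (k zero ≟ₖ l))) (weight-ones n (k ∘ suc) l)) (sym (pos-+ (δ (k zero) l) _))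
    where
    indicator : ∀ b → (if b then + 1 else + 0) ≡ + (if b then 1 else 0)
    indicator true  = refl
    indicator false = refl

  ^-pred : ∀ x {e} → 1 ≤ e → x ^ e ≡ x * x ^ (e ∸ 1)
  ^-pred x {suc e} _ = refl

  ΠKind-pow-step : ∀ (μ : Kind → ℤ) a (e : Kind → ℕ) → 1 ≤ e a →
    ΠKind (λ l → μ l ^ (δ a l ℕ.+ e l ∸ 1)) ≡ μ a * ΠKind (λ l → μ l ^ (e l ∸ 1))
  ΠKind-pow-step μ a e = step a
    where
    X : Kind → ℤ
    X l = μ l ^ (e l ∸ 1)
    pull₁ : ∀ a x y z w → a * x * y * z * w ≡ a * (x * y * z * w)
    pull₁ = solve-∀
    pull₂ : ∀ a x y z w → x * (a * y) * z * w ≡ a * (x * y * z * w)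
    pull₂ = solve-∀
    pull₃ : ∀ a x y z w → x * y * (a * z) * w ≡ a * (x * y * z * w)
    pull₃ = solve-∀
    pull₄ : ∀ a x y z w → x * y * z * (a * w) ≡ a * (x * y * z * w)
    pull₄ = solve-∀
    step : ∀ a → 1 ≤ e a → ΠKind (λ l → μ l ^ (δ a l ℕ.+ e l ∸ 1)) ≡ μ a * ΠKind X
    step a@(false , false) pos = trans (cong (λ t → t * X (true , false) * X (false , true) * X (true , true)) (^-pred (μ a) pos))
                                       (pull₁ (μ a) (X (false , false)) (X (true , false)) (X (false , true)) (X (true , true)))
    step a@(true , false) pos = trans (cong (λ t → X (false , false) * t * X (false , true) * X (true , true)) (^-pred (μ a) pos))
                                      (pull₂ (μ a) (X (false , false)) (X (true , false)) (X (false , true)) (X (true , true)))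
    step a@(false , true) pos = trans (cong (λ t → X (false , false) * X (true , false) * t * X (true , true)) (^-pred (μ a) pos))
                                      (pull₃ (μ a) (X (false , false)) (X (true , false)) (X (false , true)) (X (true , true)))
    step a@(true , true) pos = trans (cong (λ t → X (false , false) * X (true , false) * X (false , true) * t) (^-pred (μ a) pos))
                                     (pull₄ (μ a) (X (false , false)) (X (true , false)) (X (false , true)) (X (true , true)))

  count-total : ∀ n k →
    count n k (false , false) ℕ.+ count n k (true , false) ℕ.+ count n k (false , true) ℕ.+ count n k (true , true) ≡ n
  count-total zero    k = refl
  count-total (suc n) k =
    trans (regroup (δ (k zero) (false , false)) (δ (k zero) (true , false)) (δ (k zero) (false , true)) (δ (k zero) (true , true))
                   _ _ _ _)
          (cong₂ ℕ._+_ (δ-total (k zero)) (count-total n (k ∘ suc)))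
    where
    regroup : ∀ a b c d e f g h →
      (a ℕ.+ e) ℕ.+ (b ℕ.+ f) ℕ.+ (c ℕ.+ g) ℕ.+ (d ℕ.+ h) ≡ (a ℕ.+ b ℕ.+ c ℕ.+ d) ℕ.+ (e ℕ.+ f ℕ.+ g ℕ.+ h)
    regroup = ℕ-Solver.solve-∀
    δ-total : ∀ a → δ a (false , false) ℕ.+ δ a (true , false) ℕ.+ δ a (false , true) ℕ.+ δ a (true , true) ≡ 1
    δ-total (false , false) = refl
    δ-total (true  , false) = refl
    δ-total (false , true)  = refl
    δ-total (true  , true)  = refl

  allKinds⇒4≤n : ∀ n k → (∀ l → 1 ≤ count n k l) → 4 ≤ n
  allKinds⇒4≤n n k occurs = subst (4 ≤_) (count-total n k)
    (ℕₚ.+-mono-≤ (ℕₚ.+-mono-≤ (ℕₚ.+-mono-≤ (occurs _) (occurs _)) (occurs _)) (occurs _))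

  occurs-tail : ∀ n (k : Fin (suc (suc n)) → Kind) → k zero ≡ k (suc zero) →
    (∀ l → 1 ≤ count (suc (suc n)) k l) → ∀ l → 1 ≤ count (suc n) (k ∘ suc) l
  occurs-tail n k same occurs l with k zero ≟ₖ l | occurs l
  ... | yes refl | _        = subst (λ a → 1 ≤ count (suc n) (k ∘ suc) a) (sym same) (count-witness (suc n) (k ∘ suc) zero)
  ... | no  _    | occurs-l = occurs-l

  module ClassMatrix (μ : Kind → ℤ) (c : Kind → Kind → ℤ) where

    classMatrix : ∀ n → (Fin n → Kind) → (Fin n → ℤ) → Mat n
    classMatrix n k w x y = (if does (x ≟ y) then μ (k x) else + 0) + c (k x) (k y) * w y

    quotientDet : (Kind → ℤ) → ℤ
    quotientDet W = det 4 (classMatrix 4 enumKind (W ∘ enumKind))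

    quotientDet-cong : ∀ {W W'} → (∀ l → W l ≡ W' l) → quotientDet W ≡ quotientDet W'
    quotientDet-cong {W} {W'} W≗W' =
      det-cong 4 {classMatrix 4 enumKind (W ∘ enumKind)} {classMatrix 4 enumKind (W' ∘ enumKind)} λ x y →
        cong (λ v → (if does (x ≟ y) then μ (enumKind x) else + 0) + c (enumKind x) (enumKind y) * v) (W≗W' (enumKind y))

    -- A record rather than an equation, so that comparing two such types never unfolds det.
    record DetFormula n (k : Fin n → Kind) (w : Fin n → ℤ) : Set where
      constructor detFormula
      field holds : det n (classMatrix n k w) ≡ ΠKind (λ l → μ l ^ (count n k l ∸ 1)) * quotientDet (weight n k w)
    open DetFormula

    DetFormula-cong : ∀ n {k k'} w → (∀ x → k x ≡ k' x) → DetFormula n k' w → DetFormula n k w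
    DetFormula-cong n {k} {k'} w k≗k' formula = detFormula (trans (det-cong n entries) (trans (holds formula) (sym rhs)))
      where
      entries : ∀ x y → classMatrix n k w x y ≡ classMatrix n k' w x y
      entries x y = cong₂ (λ a b → (if does (x ≟ y) then μ a else + 0) + c a b * w y) (k≗k' x) (k≗k' y)
      counts : ∀ l → count n k l ≡ count n k' l
      counts l = sum-cong-≗ λ x → cong (λ a → δ a l) (k≗k' x)
      weights : ∀ l → weight n k w l ≡ weight n k' w l
      weights l = Σ-cong n λ x → cong (λ a → if does (a ≟ₖ l) then w x else + 0) (k≗k' x)
      rhs : ΠKind (λ l → μ l ^ (count n k l ∸ 1)) * quotientDet (weight n k w)
          ≡ ΠKind (λ l → μ l ^ (count n k' l ∸ 1)) * quotientDet (weight n k' w)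
      rhs = cong₂ _*_ (ΠKind-cong λ l → cong (λ e → μ l ^ (e ∸ 1)) (counts l)) (quotientDet-cong {weight n k w} {weight n k' w} weights)

    DetFormula-swapAt : ∀ n (r : Fin n) k w → DetFormula (suc n) (k ∘ swapAt r) (w ∘ swapAt r) → DetFormula (suc n) k w
    DetFormula-swapAt n r k w formula = detFormula (trans (sym lhs) (trans (holds formula) rhs))
      where
      sameDiagonal : ∀ x y → does (x ≟ y) ≡ does (swapAt r x ≟ swapAt r y)
      sameDiagonal x y = does-⇔ (mk⇔ (cong (swapAt r))
        (λ e → trans (sym (swapAt-involutive r x)) (trans (cong (swapAt r) e) (swapAt-involutive r y)))) (x ≟ y) (swapAt r x ≟ swapAt r y)
      lhs : det (suc n) (classMatrix (suc n) (k ∘ swapAt r) (w ∘ swapAt r)) ≡ det (suc n) (classMatrix (suc n) k w)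
      lhs = trans (det-cong (suc n) λ x y →
                    cong (λ b → (if b then μ (k (swapAt r x)) else + 0) + c (k (swapAt r x)) (k (swapAt r y)) * w (swapAt r y))
                         (sameDiagonal x y))
                  (det-swapBoth n r (classMatrix (suc n) k w))
      rhs : ΠKind (λ l → μ l ^ (count (suc n) (k ∘ swapAt r) l ∸ 1)) * quotientDet (weight (suc n) (k ∘ swapAt r) (w ∘ swapAt r))
          ≡ ΠKind (λ l → μ l ^ (count (suc n) k l ∸ 1)) * quotientDet (weight (suc n) k w)
      rhs = cong₂ _*_ (ΠKind-cong λ l → cong (λ e → μ l ^ (e ∸ 1)) (count-swapAt n r k l))
                      (quotientDet-cong {weight (suc n) (k ∘ swapAt r) (w ∘ swapAt r)} {weight (suc n) k w} (weight-swapAt n r k w))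

    -- Rows 0 and 1 differ only on the diagonal; the two resulting minors differ only in column 0.
    det-classMatrix-merge : ∀ n (k : Fin (suc n) → Kind) w →
      det (suc (suc n)) (classMatrix (suc (suc n)) (k zero ∷ k) w) ≡ μ (k zero) * det (suc n) (classMatrix (suc n) k (merge w))
    det-classMatrix-merge n k w =
      trans (det-rowDifference n M (μ (k zero)) (at₀ (μ (k zero)) _) (at₁ (μ (k zero)) _) (λ _ → refl))
            (cong (μ (k zero) *_) (sym (det-linear-col₀ n (minor M zero) (minor M (suc zero)) (classMatrix (suc n) k (merge w))
                                                        column₀ (λ _ _ → refl) (λ _ _ → refl))))
      where
      M : Mat (suc (suc n))
      M = classMatrix (suc (suc n)) (k zero ∷ k) w
      at₀ : ∀ m x → m + x ≡ + 0 + x + m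
      at₀ = solve-∀
      at₁ : ∀ m x → + 0 + x ≡ m + x - m
      at₁ = solve-∀
      split : ∀ d a b C → d + C * (a + b) ≡ d + C * a + (+ 0 + C * b)
      split = solve-∀
      column₀ : ∀ x → classMatrix (suc n) k (merge w) x zero ≡ minor M zero x zero + minor M (suc zero) x zero
      column₀ x = split (if does (x ≟ zero) then μ (k x) else + 0) (w (suc zero)) (w zero) (c (k x) (k zero))

    DetFormula-merge : ∀ n (k : Fin (suc n) → Kind) w → DetFormula (suc n) k (merge w) → DetFormula (suc (suc n)) (k zero ∷ k) w
    DetFormula-merge n k w formula = detFormula (begin
        det (suc (suc n)) (classMatrix (suc (suc n)) (k zero ∷ k) w)
      ≡⟨ det-classMatrix-merge n k w ⟩
        μ (k zero) * det (suc n) (classMatrix (suc n) k (merge w))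
      ≡⟨ cong (μ (k zero) *_) (holds formula) ⟩
        μ (k zero) * (Π * quotientDet (weight (suc n) k (merge w)))
      ≡⟨ sym (*-assoc (μ (k zero)) Π _) ⟩
        μ (k zero) * Π * quotientDet (weight (suc n) k (merge w))
      ≡⟨ cong₂ _*_ (sym (ΠKind-pow-step μ (k zero) (count (suc n) k) (count-witness (suc n) k zero)))
                   (quotientDet-cong {weight (suc n) k (merge w)} {weight (suc (suc n)) (k zero ∷ k) w} (λ l → sym (weight-merge n k w l))) ⟩
        ΠKind (λ l → μ l ^ (count (suc (suc n)) (k zero ∷ k) l ∸ 1)) * quotientDet (weight (suc (suc n)) (k zero ∷ k) w) ∎)
      where
      open ≡-Reasoning
      Π : ℤ
      Π = ΠKind (λ l → μ l ^ (count (suc n) k l ∸ 1))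

    DetFormula-enumKind : ∀ v → DetFormula 4 enumKind v
    DetFormula-enumKind v = detFormula (begin
        det 4 (classMatrix 4 enumKind v)
      ≡⟨ det-cong 4 {classMatrix 4 enumKind v} {classMatrix 4 enumKind (W ∘ enumKind)}
                  (λ x y → cong (λ t → (if does (x ≟ y) then μ (enumKind x) else + 0) + c (enumKind x) (enumKind y) * t)
                                (sym (weight-enumKind y))) ⟩
        quotientDet W
      ≡⟨ sym (*-identityˡ (quotientDet W)) ⟩
        + 1 * quotientDet W
      ≡⟨ cong (_* quotientDet W) allOnce ⟩
        ΠKind (λ l → μ l ^ (count 4 enumKind l ∸ 1)) * quotientDet W ∎)
      where
      open ≡-Reasoning
      W : Kind → ℤ
      W = weight 4 enumKind v
      allOnce : + 1 ≡ ΠKind (λ l → μ l ^ (count 4 enumKind l ∸ 1))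
      allOnce = refl
      enumKind-injective : ∀ {x y} → enumKind x ≡ enumKind y → x ≡ y
      enumKind-injective {x} {y} e = trans (sym (indexKind-enumKind x)) (trans (cong indexKind e) (indexKind-enumKind y))
      weight-enumKind : ∀ j → W (enumKind j) ≡ v j
      weight-enumKind j = trans (Σ-cong 4 λ x → cong (λ b → if b then v x else + 0)
                                                    (does-⇔ (mk⇔ enumKind-injective (cong enumKind)) (enumKind x ≟ₖ enumKind j) (x ≟ j)))
                                (Σ-indicator 4 j v)

    DetFormula-allKinds₄ : ∀ k w → (∀ l → 1 ≤ count 4 k l) → DetFormula 4 k w
    DetFormula-allKinds₄ k w occurs =
      DetFormula-cong 4 {k} {k₄} w (λ { zero → refl ; (suc zero) → refl ; (suc (suc zero)) → refl ; (suc (suc (suc zero))) → refl })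
                      unsorted
      where
      k₄ : Fin 4 → Kind
      k₄ = k zero ∷ k (suc zero) ∷ k (suc (suc zero)) ∷ k (suc (suc (suc zero))) ∷ []
      sorting : Fin 4 → Fin 4
      sorting = bubbleSort bubbleNetwork k₄
      isSorted : ∀ x → k₄ (sorting x) ≡ enumKind x
      isSorted = bubbleSort-enumKind (k zero) (k (suc zero)) (k (suc (suc zero))) (k (suc (suc (suc zero)))) occurs
      sorted : DetFormula 4 (k₄ ∘ sorting) (w ∘ sorting)
      sorted = DetFormula-cong 4 {k₄ ∘ sorting} {enumKind} (w ∘ sorting) isSorted (DetFormula-enumKind (w ∘ sorting))
      unsorted : DetFormula 4 k₄ w
      unsorted = bubbleSort-reflects (DetFormula 4) (DetFormula-swapAt 3) bubbleNetwork k₄ w sorted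

    det-classMatrix : ∀ n k w → (∀ l → 1 ≤ count n k l) → DetFormula n k w
    det-classMatrix n k w occurs with allKinds⇒4≤n n k occurs
    ... | s≤s (s≤s (s≤s (s≤s _))) = fromFour _ k w occurs
      where
      Occurring : ∀ n → (Fin n → Kind) → (Fin n → ℤ) → Set
      Occurring n k w = (∀ l → 1 ≤ count n k l) → DetFormula n k w
      fromFour : ∀ m k w → Occurring (4 ℕ.+ m) k w
      fromFour zero    = DetFormula-allKinds₄
      fromFour (suc m) k w with pigeonhole (s≤s (s≤s (s≤s (s≤s (s≤s z≤n))))) (indexKind ∘ k)
      ... | x , y , x<y , sameIndex =
        sameLabel-to-front (Occurring (5 ℕ.+ m)) swapped front x y k w x<y
          (trans (sym (enumKind-indexKind (k x))) (trans (cong enumKind sameIndex) (enumKind-indexKind (k y))))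
        where
        swapped : ∀ r k w → Occurring (5 ℕ.+ m) (k ∘ swapAt r) (w ∘ swapAt r) → Occurring (5 ℕ.+ m) k w
        swapped r k w formula occurs =
          DetFormula-swapAt (4 ℕ.+ m) r k w (formula λ l → subst (1 ≤_) (sym (count-swapAt (4 ℕ.+ m) r k l)) (occurs l))
        front : ∀ k w → k zero ≡ k (suc zero) → Occurring (5 ℕ.+ m) k w
        front k w same occurs =
          DetFormula-cong (5 ℕ.+ m) {k} {k (suc zero) ∷ k ∘ suc} w (λ { zero → same ; (suc x) → refl })
            (DetFormula-merge (3 ℕ.+ m) (k ∘ suc) w (fromFour m (k ∘ suc) (merge w) (occurs-tail (3 ℕ.+ m) k same occurs)))

module Counting where

  open import Data.Nat using (ℕ; zero; suc; _+_; _*_; _<_; z≤n; s≤s)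
  import Data.Nat.Properties as ℕₚ
  open import Data.Nat.Divisibility using (_∣?_; _∣0; ∣⇒≤; ∣-refl; ∣m+n∣m⇒∣n; ∣m∣n⇒∣m+n)
  open import Data.Bool using (Bool; true; false)
  open import Data.List using (filter; length; applyUpTo)
  open import Data.Fin using (toℕ)
  open import Function using (_∘_; mk⇔)
  open import Relation.Nullary using (does)
  open import Relation.Nullary.Decidable using (dec-true; dec-false; does-⇔)
  open import Relation.Unary using (Decidable)
  open import Relation.Binary.PropositionalEquality
  open import Algebra.Properties.CommutativeSemigroup ℕₚ.+-commutativeSemigroup using (interchange)
  open import Algebra.Properties.CommutativeMonoid.Sum ℕₚ.+-0-commutativeMonoid using (sum)

  ind : Bool → ℕ
  ind true  = 1
  ind false = 0

  sumBelow : ℕ → (ℕ → ℕ) → ℕ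
  sumBelow zero    f = 0
  sumBelow (suc n) f = f 0 + sumBelow n (f ∘ suc)

  sum-toℕ : ∀ n (f : ℕ → ℕ) → sum {n} (f ∘ toℕ) ≡ sumBelow n f
  sum-toℕ zero    f = refl
  sum-toℕ (suc n) f = cong (_+_ (f 0)) (sum-toℕ n (f ∘ suc))

  sumBelow-cong : ∀ n {f g : ℕ → ℕ} → (∀ i → f i ≡ g i) → sumBelow n f ≡ sumBelow n g
  sumBelow-cong zero    f≗g = refl
  sumBelow-cong (suc n) f≗g = cong₂ _+_ (f≗g 0) (sumBelow-cong n (f≗g ∘ suc))

  sumBelow-+ : ∀ n (f g : ℕ → ℕ) → sumBelow n (λ i → f i + g i) ≡ sumBelow n f + sumBelow n g
  sumBelow-+ zero    f g = refl
  sumBelow-+ (suc n) f g = trans (cong (_+_ (f 0 + g 0)) (sumBelow-+ n (f ∘ suc) (g ∘ suc)))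
                                 (interchange (f 0) (g 0) _ _)

  sumBelow-split : ∀ a b (f : ℕ → ℕ) → sumBelow (a + b) f ≡ sumBelow a f + sumBelow b (λ i → f (a + i))
  sumBelow-split zero    b f = refl
  sumBelow-split (suc a) b f = trans (cong (_+_ (f 0)) (sumBelow-split a b (f ∘ suc))) (sym (ℕₚ.+-assoc (f 0) _ _))

  sumBelow-zero : ∀ n (f : ℕ → ℕ) → (∀ i → i < n → f i ≡ 0) → sumBelow n f ≡ 0
  sumBelow-zero zero    f _      = refl
  sumBelow-zero (suc n) f f<n≡0 = cong₂ _+_ (f<n≡0 0 (s≤s z≤n)) (sumBelow-zero n (f ∘ suc) λ i i<n → f<n≡0 (suc i) (s≤s i<n))

  sumBelow-rotate : ∀ n (f : ℕ → ℕ) → f 0 ≡ f n → sumBelow n (f ∘ suc) ≡ sumBelow n f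
  sumBelow-rotate n f f0≡fn = ℕₚ.+-cancelˡ-≡ (f 0) _ _ (begin
      f 0 + sumBelow n (f ∘ suc)   ≡⟨ cong (λ m → sumBelow m f) (ℕₚ.+-comm 1 n) ⟩
      sumBelow (n + 1) f           ≡⟨ sumBelow-split n 1 f ⟩
      sumBelow n f + (f (n + 0) + 0) ≡⟨ cong (λ x → sumBelow n f + (f x + 0)) (ℕₚ.+-identityʳ n) ⟩
      sumBelow n f + (f n + 0)     ≡⟨ cong (_+_ (sumBelow n f)) (trans (ℕₚ.+-identityʳ (f n)) (sym f0≡fn)) ⟩
      sumBelow n f + f 0           ≡⟨ ℕₚ.+-comm (sumBelow n f) (f 0) ⟩
      f 0 + sumBelow n f           ∎)
    where open ≡-Reasoning

  length-filter-applyUpTo : ∀ {P : ℕ → Set} (P? : Decidable P) g n →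
    length (filter P? (applyUpTo g n)) ≡ sumBelow n (λ i → ind (does (P? (g i))))
  length-filter-applyUpTo P? g zero = refl
  length-filter-applyUpTo P? g (suc n) with does (P? (g 0))
  ... | true  = cong suc (length-filter-applyUpTo P? (g ∘ suc) n)
  ... | false = length-filter-applyUpTo P? (g ∘ suc) n

  -- each block d·j, …, d·j + d - 1 contains exactly one multiple of d
  multiples-below : ∀ d M → sumBelow (suc d * M) (λ i → ind (does (suc d ∣? i))) ≡ M
  multiples-below d zero    = cong (λ m → sumBelow m (λ i → ind (does (suc d ∣? i)))) (ℕₚ.*-zeroʳ (suc d))
  multiples-below d (suc M) = begin
      sumBelow (suc d * suc M) isMultiple
    ≡⟨ cong (λ m → sumBelow m isMultiple) (ℕₚ.*-suc (suc d) M) ⟩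
      sumBelow (suc d + suc d * M) isMultiple
    ≡⟨ sumBelow-split (suc d) (suc d * M) isMultiple ⟩
      sumBelow (suc d) isMultiple + sumBelow (suc d * M) (λ i → isMultiple (suc d + i))
    ≡⟨ cong₂ _+_ firstBlock (sumBelow-cong (suc d * M) shift) ⟩
      1 + sumBelow (suc d * M) isMultiple
    ≡⟨ cong suc (multiples-below d M) ⟩
      suc M ∎
    where
    open ≡-Reasoning
    isMultiple : ℕ → ℕ
    isMultiple i = ind (does (suc d ∣? i))
    firstBlock : sumBelow (suc d) isMultiple ≡ 1
    firstBlock = cong₂ _+_ (cong ind (dec-true (suc d ∣? 0) (suc d ∣0)))
      (sumBelow-zero d (isMultiple ∘ suc) λ i i<d → cong ind (dec-false (suc d ∣? suc i)
        λ d∣i → ℕₚ.<-irrefl refl (ℕₚ.<-≤-trans (s≤s i<d) (∣⇒≤ d∣i))))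
    shift : ∀ i → isMultiple (suc d + i) ≡ isMultiple i
    shift i = cong ind (does-⇔ (mk⇔ (λ d∣d+i → ∣m+n∣m⇒∣n d∣d+i ∣-refl) (∣m∣n⇒∣m+n ∣-refl)) (suc d ∣? (suc d + i)) (suc d ∣? i))

module Comaximality where

  open import Data.Nat as ℕ using (ℕ; zero; suc; _+_; _*_; _<_; z≤n; s≤s; _≡ᵇ_)
  import Data.Nat.Properties as ℕₚ
  open import Data.Nat.DivMod using (_%_; m%n<n; m<n⇒m%n≡m; [m+kn]%n≡m%n; [m+n]%n≡m%n; %-distribˡ-*; m%n%n≡m%n)
  open import Data.Nat.Divisibility using (_∣_; _∣?_; ∣⇒≤; ∣-trans; n∣m*n; ∣1⇒≡1; %-presˡ-∣; ∣m+n∣m⇒∣n; ∣m∣n⇒∣m+n)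
  open import Data.Nat.Coprimality using (Coprime; coprime-Bézout; coprime-divisor; coprime⇒gcd≡1)
  open import Data.Nat.GCD using (gcd; gcd-greatest; module Bézout)
  open import Data.Nat.Primality using (Prime; prime⇒irreducible; prime⇒nonTrivial)
  open import Data.Nat.Base using (nonTrivial⇒n>1)
  open import Data.Bool using (Bool; true; false; T; not; _∧_)
  open import Data.Bool.ListAction using (any)
  open import Data.List using (upTo)
  open import Data.List.Relation.Unary.Any.Properties using (any⁺; any⁻; applyUpTo⁺; applyUpTo⁻)
  open import Data.Product using (_×_; _,_; ∃-syntax)
  open import Data.Sum using (inj₁; inj₂)
  open import Function using (id)
  open import Relation.Nullary using (¬_; Dec; yes; no; does; contradiction)
  open import Relation.Binary.PropositionalEquality
  import Data.Nat.Tactic.RingSolver as ℕ-Solver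

  prime>1 : ∀ {p} → Prime p → 1 < p
  prime>1 {p} p-prime = nonTrivial⇒n>1 p {{prime⇒nonTrivial p-prime}}

  ¬∣⇒coprime : ∀ {p} w → Prime p → ¬ p ∣ w → Coprime w p
  ¬∣⇒coprime w p-prime p∤w (d∣w , d∣p) with prime⇒irreducible p-prime d∣p
  ... | inj₁ d≡1 = d≡1
  ... | inj₂ refl = contradiction d∣w p∤w

  coprime-*ʳ : ∀ {w a b} → Coprime w a → Coprime w b → Coprime w (a * b)
  coprime-*ʳ w⊥a w⊥b (d∣w , d∣ab) = w⊥b (d∣w , coprime-divisor (λ (e∣d , e∣a) → w⊥a (∣-trans e∣d d∣w , e∣a)) d∣ab)

  coprime-^ʳ : ∀ {w a} → Coprime w a → ∀ e → Coprime w (a ℕ.^ e)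
  coprime-^ʳ w⊥a zero    (_ , d∣1) = ∣1⇒≡1 d∣1
  coprime-^ʳ w⊥a (suc e) = coprime-*ʳ w⊥a (coprime-^ʳ w⊥a e)

  ¬∣1 : ∀ {r} → 1 < r → ¬ r ∣ 1
  ¬∣1 1<r r∣1 = ℕₚ.<-irrefl (sym (∣1⇒≡1 r∣1)) 1<r

  module Modulo (m : ℕ) (1<n : 1 < suc m) where

    private
      n : ℕ
      n = suc m

    1%n≡1 : 1 % n ≡ 1
    1%n≡1 = m<n⇒m%n≡m 1<n

    %-absorbˡ : ∀ a w → (a % n * w) % n ≡ (a * w) % n
    %-absorbˡ a w = begin
        (a % n * w) % n             ≡⟨ %-distribˡ-* (a % n) w n ⟩
        (a % n % n * (w % n)) % n   ≡⟨ cong (λ t → (t * (w % n)) % n) (m%n%n≡m%n a n) ⟩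
        (a % n * (w % n)) % n       ≡⟨ %-distribˡ-* a w n ⟨
        (a * w) % n                 ∎
      where open ≡-Reasoning

    invertible : ∀ w → Coprime w n → ∃[ u ] u < n × (u * w) % n ≡ 1
    invertible w w⊥n with coprime-Bézout w⊥n
    ... | Bézout.+- x y eq = x % n , m%n<n x n , (begin
        (x % n * w) % n   ≡⟨ %-absorbˡ x w ⟩
        (x * w) % n       ≡⟨ cong (_% n) (sym eq) ⟩
        (1 + y * n) % n   ≡⟨ [m+kn]%n≡m%n 1 y n ⟩
        1 % n             ≡⟨ 1%n≡1 ⟩
        1                 ∎)
      where open ≡-Reasoning
    -- here 1 + x w = y n, so x (n - 1) is the inverse
    ... | Bézout.-+ x y eq = (x * m) % n , m%n<n (x * m) n , (begin
        ((x * m) % n * w) % n        ≡⟨ %-absorbˡ (x * m) w ⟩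
        (x * m * w) % n              ≡⟨ [m+n]%n≡m%n (x * m * w) n ⟨
        (x * m * w + n) % n          ≡⟨ cong (_% n) (expand x w m) ⟩
        suc ((1 + x * w) * m) % n    ≡⟨ cong (_% n) (cong (λ t → suc (t * m)) eq) ⟩
        suc (y * n * m) % n          ≡⟨ cong (_% n) (regroup y m) ⟩
        (1 + (y * m) * n) % n        ≡⟨ [m+kn]%n≡m%n 1 (y * m) n ⟩
        1 % n                        ≡⟨ 1%n≡1 ⟩
        1                            ∎)
      where
      open ≡-Reasoning
      expand : ∀ x w m → x * m * w + suc m ≡ suc ((1 + x * w) * m)
      expand = ℕ-Solver.solve-∀
      regroup : ∀ y m → suc (y * suc m * m) ≡ 1 + (y * m) * suc m
      regroup = ℕ-Solver.solve-∀

    -- the search performed by comaxAdj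
    generatesOne : ℕ → ℕ → Bool
    generatesOne x y = any (λ a → any (λ b → ((a * x + b * y) % n) ≡ᵇ (1 % n)) (upTo n)) (upTo n)

    generatesOne⁺ : ∀ {x y} a b → a < n → b < n → (a * x + b * y) % n ≡ 1 → T (generatesOne x y)
    generatesOne⁺ a b a<n b<n eq =
      any⁺ _ (applyUpTo⁺ id (any⁺ _ (applyUpTo⁺ id (ℕₚ.≡⇒≡ᵇ _ _ (trans eq (sym 1%n≡1))) b<n)) a<n)

    generatesOne⁻ : ∀ {x y} → T (generatesOne x y) → ∃[ a ] ∃[ b ] (a * x + b * y) % n ≡ 1
    generatesOne⁻ {x} {y} gen with applyUpTo⁻ id (any⁻ _ (upTo n) gen)
    ... | a , _ , gen-a with applyUpTo⁻ id (any⁻ _ (upTo n) gen-a)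
    ...   | b , _ , eq = a , b , trans (ℕₚ.≡ᵇ⇒≡ _ _ eq) 1%n≡1

  module TwoPrimes (p q m : ℕ) (p-prime : Prime p) (q-prime : Prime q) (p∣n : p ∣ suc m) (q∣n : q ∣ suc m)
                   (support : ∀ w → ¬ p ∣ w → ¬ q ∣ w → Coprime w (suc m)) where

    n : ℕ
    n = suc m

    1<n : 1 < n
    1<n = ℕₚ.<-≤-trans (prime>1 p-prime) (∣⇒≤ p∣n)

    open Modulo m 1<n public

    private
      T⇒≡true : ∀ {b} → T b → b ≡ true
      T⇒≡true {true} _ = refl

      generates : ∀ {x y} a b → a < n → b < n → (a * x + b * y) % n ≡ 1 → generatesOne x y ≡ true
      generates a b a<n b<n eq = T⇒≡true (generatesOne⁺ a b a<n b<n eq)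

      0<n : 0 < n
      0<n = s≤s z≤n

    generatesOne-unitˡ : ∀ x y → ¬ p ∣ x → ¬ q ∣ x → generatesOne x y ≡ true
    generatesOne-unitˡ x y p∤x q∤x with invertible x (support x p∤x q∤x)
    ... | u , u<n , inverse = generates u 0 u<n 0<n (trans (cong (_% n) (ℕₚ.+-identityʳ (u * x))) inverse)

    generatesOne-unitʳ : ∀ x y → ¬ p ∣ y → ¬ q ∣ y → generatesOne x y ≡ true
    generatesOne-unitʳ x y p∤y q∤y with invertible y (support y p∤y q∤y)
    ... | u , u<n , inverse = generates 0 u 0<n u<n inverse

    generatesOne-unit-sum : ∀ x y → ¬ p ∣ x + y → ¬ q ∣ x + y → generatesOne x y ≡ true
    generatesOne-unit-sum x y p∤x+y q∤x+y with invertible (x + y) (support (x + y) p∤x+y q∤x+y)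
    ... | u , u<n , inverse = generates u u u<n u<n (trans (cong (_% n) (sym (ℕₚ.*-distribˡ-+ u x y))) inverse)

    generatesOne-commonDivisor : ∀ x y {r} → r ∣ n → 1 < r → r ∣ x → r ∣ y → generatesOne x y ≡ false
    generatesOne-commonDivisor x y {r} r∣n 1<r r∣x r∣y with generatesOne x y in gen
    ... | false = refl
    ... | true with generatesOne⁻ {x} {y} (subst T (sym gen) _)
    ...   | a , b , eq =
      contradiction (subst (r ∣_) eq (%-presˡ-∣ (∣m∣n⇒∣m+n (∣-trans r∣x (n∣m*n a)) (∣-trans r∣y (n∣m*n b))) r∣n))
                                       (¬∣1 1<r)

    -- ⟨x⟩ + ⟨y⟩ = ℤₙ iff neither p nor q divides both: otherwise one of x, y, x + y is a unit.
    generatesOne-iff : ∀ x y → generatesOne x y ≡ (not (does (p ∣? x) ∧ does (p ∣? y)) ∧ not (does (q ∣? x) ∧ does (q ∣? y)))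
    generatesOne-iff x y with p ∣? x | q ∣? x | p ∣? y | q ∣? y
    ... | yes p∣x | _       | yes p∣y | _       = generatesOne-commonDivisor x y p∣n (prime>1 p-prime) p∣x p∣y
    ... | no  _   | yes q∣x | no  _   | yes q∣y = generatesOne-commonDivisor x y q∣n (prime>1 q-prime) q∣x q∣y
    ... | yes _   | yes q∣x | no  _   | yes q∣y = generatesOne-commonDivisor x y q∣n (prime>1 q-prime) q∣x q∣y
    ... | no  _   | yes q∣x | yes _   | yes q∣y = generatesOne-commonDivisor x y q∣n (prime>1 q-prime) q∣x q∣y
    ... | no  p∤x | no  q∤x | _       | _       = generatesOne-unitˡ x y p∤x q∤x
    ... | yes _   | no  _   | no  p∤y | no  q∤y = generatesOne-unitʳ x y p∤y q∤y
    ... | no  _   | yes _   | no  p∤y | no  q∤y = generatesOne-unitʳ x y p∤y q∤y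
    ... | yes _   | yes _   | no  p∤y | no  q∤y = generatesOne-unitʳ x y p∤y q∤y
    ... | yes p∣x | no  q∤x | no  p∤y | yes q∣y =
      generatesOne-unit-sum x y (λ p∣x+y → p∤y (∣m+n∣m⇒∣n p∣x+y p∣x))
                                (λ q∣x+y → q∤x (∣m+n∣m⇒∣n (subst (q ∣_) (ℕₚ.+-comm x y) q∣x+y) q∣y))
    ... | no  p∤x | yes q∣x | yes p∣y | no  q∤y =
      generatesOne-unit-sum x y (λ p∣x+y → p∤x (∣m+n∣m⇒∣n (subst (p ∣_) (ℕₚ.+-comm x y) p∣x+y) p∣y))
                                (λ q∣x+y → q∤y (∣m+n∣m⇒∣n q∣x+y q∣x))

    unit-iff : ∀ i → does (gcd i n ℕ.≟ 1) ≡ (not (does (p ∣? i)) ∧ not (does (q ∣? i)))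
    unit-iff i = decide (p ∣? i) (q ∣? i) (gcd i n ℕ.≟ 1)
      where
      decide : (p∣?i : Dec (p ∣ i)) (q∣?i : Dec (q ∣ i)) (unit? : Dec (gcd i n ≡ 1)) → does unit? ≡ (not (does p∣?i) ∧ not (does q∣?i))
      decide (yes p∣i) _         (yes gcd≡1) = contradiction (subst (p ∣_) gcd≡1 (gcd-greatest p∣i p∣n)) (¬∣1 (prime>1 p-prime))
      decide (yes _)   _         (no  _)     = refl
      decide (no  _)   (yes q∣i) (yes gcd≡1) = contradiction (subst (q ∣_) gcd≡1 (gcd-greatest q∣i q∣n)) (¬∣1 (prime>1 q-prime))
      decide (no  _)   (yes _)   (no  _)     = refl
      decide (no  _)   (no  _)   (yes _)     = refl
      decide (no  p∤i) (no  q∤i) (no  gcd≢1) = contradiction (coprime⇒gcd≡1 (support i p∤i q∤i)) gcd≢1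

module Spectrum where

  open Determinant
  open Kinds
  open Counting
  open Comaximality
  open import Data.Nat as ℕ using (ℕ; zero; suc; _≤_; _∸_)
  import Data.Nat.Properties as ℕₚ
  import Data.Nat.Tactic.RingSolver as ℕ-Solver
  open import Data.Nat.Divisibility using (_∣_; _∣?_; m∣m*n; n∣m*n; ∣-trans; ∣-antisym; ∣-refl)
  open import Data.Nat.GCD using (gcd; gcd-identityˡ; gcd[m,n]∣m; gcd-greatest)
  open import Data.Nat.LCM using (lcm; lcm-least; gcd*lcm)
  open import Data.Nat.Coprimality as Coprimality using (Coprime; coprime⇒gcd≡1; prime⇒coprime)
  open import Data.Nat.Primality using (Prime)
  open import Data.Fin using (Fin; toℕ; _≟_; fromℕ<)
  open import Data.Fin.Properties using (toℕ-fromℕ<)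
  open import Relation.Nullary using (¬_; Dec; does; yes; no)
  open import Relation.Nullary.Decidable using (dec-true; dec-false)
  open import Data.Integer as ℤ using (ℤ; +_; -_; _+_; _*_; _-_; _^_)
  open import Data.Integer.Properties using (pos-+; *-identityʳ)
  open import Data.Bool using (Bool; true; false; not; _∧_; if_then_else_)
  open import Data.Product using (_,_; _×_; proj₁; proj₂)
  open import Function using (_∘_)
  open import Relation.Binary.PropositionalEquality
  open import Data.Integer.Tactic.RingSolver using (solve-∀)

  comaximalᵇ : Kind → Kind → Bool
  comaximalᵇ (a , b) (a' , b') = not (a ∧ a') ∧ not (b ∧ b')

  comaximal : Kind → Kind → ℤ
  comaximal l l' = b2z (comaximalᵇ l l')

  -- z minus the degree of a vertex of kind l, when W l' vertices have kind l'
  shifted : ℤ → (Kind → ℤ) → Kind → ℤ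
  shifted z W l = z - ΣKind (λ l' → comaximal l l' * W l')

  quotientDet-comaximal : ∀ z F A B T → let W = byKind F A B T in
    ClassMatrix.quotientDet (shifted z W) comaximal W ≡ (z - (F + A + B + T)) * (z - F) * (z - (F + A + B)) * z
  quotientDet-comaximal z F A B T =
    trans (det-4 (ClassMatrix.classMatrix (shifted z W) comaximal 4 enumKind (W ∘ enumKind))) (cofactor-expansion z F A B T)
    where
    W : Kind → ℤ
    W = byKind F A B T
    -- the entries δ·μ + coupling·weight of the quotient matrix, exactly as classMatrix computes them
    cofactor-expansion : ∀ z F A B T →
      let μU  = z - (+ 1 * F + + 1 * A + + 1 * B + + 1 * T)
          μP  = z - (+ 1 * F + + 0 * A + + 1 * B + + 0 * T)
          μQ  = z - (+ 1 * F + + 1 * A + + 0 * B + + 0 * T)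
          μPQ = z - (+ 1 * F + + 0 * A + + 0 * B + + 0 * T)
          a = μU + + 1 * F ; b = + 0 + + 1 * A ; c = + 0 + + 1 * B ; d = + 0 + + 1 * T
          e = + 0 + + 1 * F ; f = μP + + 0 * A ; g = + 0 + + 1 * B ; h = + 0 + + 0 * T
          i = + 0 + + 1 * F ; j = + 0 + + 1 * A ; k = μQ + + 0 * B ; l = + 0 + + 0 * T
          m = + 0 + + 1 * F ; n = + 0 + + 0 * A ; o = + 0 + + 0 * B ; p = μPQ + + 0 * T
      in a * (f * (k * p - l * o) - g * (j * p - l * n) + h * (j * o - k * n))
       - b * (e * (k * p - l * o) - g * (i * p - l * m) + h * (i * o - k * m))
       + c * (e * (j * p - l * n) - f * (i * p - l * m) + h * (i * n - j * m))
       - d * (e * (j * o - k * n) - f * (i * o - k * m) + g * (i * n - j * m))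
       ≡ (z - (F + A + B + T)) * (z - F) * (z - (F + A + B)) * z
    cofactor-expansion = solve-∀

  private
    pos-+₄ : ∀ f a b t → + (f ℕ.+ a ℕ.+ b ℕ.+ t) ≡ + f + + a + + b + + t
    pos-+₄ f a b t = trans (pos-+ (f ℕ.+ a ℕ.+ b) t) (cong (_+ + t) (trans (pos-+ (f ℕ.+ a) b) (cong (_+ + b) (pos-+ f a))))

  shifted-byKind : ∀ z f a b t l → shifted z (byKind (+ f) (+ a) (+ b) (+ t)) l
                   ≡ byKind (z - + (f ℕ.+ a ℕ.+ b ℕ.+ t)) (z - + (b ℕ.+ f)) (z - + (a ℕ.+ f)) (z - + f) l
  shifted-byKind z f a b t (false , false) = trans (weighted z (+ f) (+ a) (+ b) (+ t)) (cong (_-_ z) (sym (pos-+₄ f a b t)))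
    where
    weighted : ∀ z F A B T → z - (+ 1 * F + + 1 * A + + 1 * B + + 1 * T) ≡ z - (F + A + B + T)
    weighted = solve-∀
  shifted-byKind z f a b t (true , false) = trans (weighted z (+ f) (+ a) (+ b) (+ t)) (cong (_-_ z) (sym (pos-+ b f)))
    where
    weighted : ∀ z F A B T → z - (+ 1 * F + + 0 * A + + 1 * B + + 0 * T) ≡ z - (B + F)
    weighted = solve-∀
  shifted-byKind z f a b t (false , true) = trans (weighted z (+ f) (+ a) (+ b) (+ t)) (cong (_-_ z) (sym (pos-+ a f)))
    where
    weighted : ∀ z F A B T → z - (+ 1 * F + + 1 * A + + 0 * B + + 0 * T) ≡ z - (A + F)
    weighted = solve-∀
  shifted-byKind z f a b t (true , true) = weighted z (+ f) (+ a) (+ b) (+ t)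
    where
    weighted : ∀ z F A B T → z - (+ 1 * F + + 0 * A + + 0 * B + + 0 * T) ≡ z - F
    weighted = solve-∀

  quotientDet-comaximal-ℕ : ∀ z f a b t → let W = byKind (+ f) (+ a) (+ b) (+ t) in
    ClassMatrix.quotientDet (shifted z W) comaximal W ≡ (z - + (f ℕ.+ a ℕ.+ b ℕ.+ t)) * (z - + f) * (z - + (a ℕ.+ b ℕ.+ f)) * z
  quotientDet-comaximal-ℕ z f a b t =
    trans (quotientDet-comaximal z (+ f) (+ a) (+ b) (+ t))
          (cong₂ (λ u s → (z - u) * (z - + f) * (z - s) * z) (sym (pos-+₄ f a b t)) (sym pos-+₃))
    where
    rotate : ∀ a b f → a + b + f ≡ f + a + b
    rotate = solve-∀
    pos-+₃ : + (a ℕ.+ b ℕ.+ f) ≡ + f + + a + + b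
    pos-+₃ = trans (pos-+ (a ℕ.+ b) f) (trans (cong (_+ + f) (pos-+ a b)) (rotate (+ a) (+ b) (+ f)))

  spectrum-factorisation : ∀ z f a b t → 1 ≤ f → 1 ≤ t →
    let W = byKind (+ f) (+ a) (+ b) (+ t); μ = shifted z W in
    ΠKind (λ l → μ l ^ (byKind f a b t l ∸ 1)) * ClassMatrix.quotientDet μ comaximal W
    ≡ (z - + (f ℕ.+ a ℕ.+ b ℕ.+ t)) ^ f * (z - + (b ℕ.+ f)) ^ (a ∸ 1) * (z - + (a ℕ.+ f)) ^ (b ∸ 1)
      * (z - + f) ^ t * (z - + (a ℕ.+ b ℕ.+ f)) * (z - + 0)
  spectrum-factorisation z f a b t 1≤f 1≤t = begin
      ΠKind (λ l → shifted z W l ^ (byKind f a b t l ∸ 1)) * ClassMatrix.quotientDet (shifted z W) comaximal W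
    ≡⟨ cong₂ _*_ (ΠKind-cong λ l → cong (_^ (byKind f a b t l ∸ 1)) (shifted-byKind z f a b t l)) (quotientDet-comaximal-ℕ z f a b t) ⟩
      U ^ (f ∸ 1) * P ^ (a ∸ 1) * Q ^ (b ∸ 1) * R ^ (t ∸ 1) * (U * R * S * z)
    ≡⟨ regroup U R S z (P ^ (a ∸ 1)) (Q ^ (b ∸ 1)) (U ^ (f ∸ 1)) (R ^ (t ∸ 1)) ⟩
      U * U ^ (f ∸ 1) * P ^ (a ∸ 1) * Q ^ (b ∸ 1) * (R * R ^ (t ∸ 1)) * S * (z - + 0)
    ≡⟨ cong₂ (λ u r → u * P ^ (a ∸ 1) * Q ^ (b ∸ 1) * r * S * (z - + 0)) (sym (^-pred U 1≤f)) (sym (^-pred R 1≤t)) ⟩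
      U ^ f * P ^ (a ∸ 1) * Q ^ (b ∸ 1) * R ^ t * S * (z - + 0) ∎
    where
    open ≡-Reasoning
    W : Kind → ℤ
    W = byKind (+ f) (+ a) (+ b) (+ t)
    U P Q R S : ℤ
    U = z - + (f ℕ.+ a ℕ.+ b ℕ.+ t)
    P = z - + (b ℕ.+ f)
    Q = z - + (a ℕ.+ f)
    R = z - + f
    S = z - + (a ℕ.+ b ℕ.+ f)
    regroup : ∀ U R S z P' Q' Uf Rt → Uf * P' * Q' * Rt * (U * R * S * z) ≡ U * Uf * P' * Q' * (R * Rt) * S * (z - + 0)
    regroup = solve-∀

  *-pred-sum : ∀ t p q → 1 ≤ p → 1 ≤ q → t ℕ.* (q ∸ 1) ℕ.+ t ℕ.* (p ∸ 1) ≡ t ℕ.* ((p ℕ.+ q) ∸ 2)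
  *-pred-sum t (suc p) (suc q) _ _ = trans (distrib t q p) (cong (λ s → t ℕ.* (s ∸ 1)) (sym (ℕₚ.+-suc p q)))
    where
    distrib : ∀ t q p → t ℕ.* q ℕ.+ t ℕ.* p ≡ t ℕ.* (p ℕ.+ q)
    distrib = ℕ-Solver.solve-∀

  module ComaximalGraph (p q m t : ℕ) (p-prime : Prime p) (q-prime : Prime q) (p<q : p ℕ.< q)
                        (n≡pqt : suc m ≡ p ℕ.* q ℕ.* t)
                        (support : ∀ w → ¬ p ∣ w → ¬ q ∣ w → Coprime w (suc m)) where

    private
      n≡p[qt] : suc m ≡ p ℕ.* (q ℕ.* t)
      n≡p[qt] = trans n≡pqt (ℕₚ.*-assoc p q t)
      n≡q[pt] : suc m ≡ q ℕ.* (p ℕ.* t)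
      n≡q[pt] = trans n≡pqt (swap p q t)
        where
        swap : ∀ p q t → p ℕ.* q ℕ.* t ≡ q ℕ.* (p ℕ.* t)
        swap = ℕ-Solver.solve-∀

    open TwoPrimes p q m p-prime q-prime (subst (p ∣_) (sym n≡p[qt]) (m∣m*n (q ℕ.* t)))
                   (subst (q ∣_) (sym n≡q[pt]) (m∣m*n (p ℕ.* t))) support public

    kindOf : ℕ → Kind
    kindOf i = does (p ∣? i) , does (q ∣? i)

    kind : Fin n → Kind
    kind x = kindOf (toℕ x)

    comaxAdj-kind : ∀ x y → comaxAdj n x y ≡ not (does (x ≟ y)) ∧ comaximalᵇ (kind x) (kind y)
    comaxAdj-kind x y = cong (not (does (x ≟ y)) ∧_) (generatesOne-iff (toℕ x) (toℕ y))

    private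
      indicators : ∀ a b → δ (a , b) (false , false) ≡ ind (not a ∧ not b)
                         × δ (a , b) (true , false) ℕ.+ δ (a , b) (true , true) ≡ ind a
                         × δ (a , b) (false , true) ℕ.+ δ (a , b) (true , true) ≡ ind b
                         × δ (a , b) (true , true) ≡ ind (a ∧ b)
      indicators false false = refl , refl , refl , refl
      indicators true  false = refl , refl , refl , refl
      indicators false true  = refl , refl , refl , refl
      indicators true  true  = refl , refl , refl , refl

      multiples : ∀ d M → 1 ≤ d → n ≡ d ℕ.* M → sumBelow n (λ i → ind (does (d ∣? i))) ≡ M
      multiples (suc d) M _ n≡dM = subst (λ k → sumBelow k (λ i → ind (does (suc d ∣? i))) ≡ M) (sym n≡dM) (multiples-below d M)

      cancel-multiple : ∀ x t q → 1 ≤ q → x ℕ.+ t ≡ q ℕ.* t → x ≡ t ℕ.* (q ∸ 1)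
      cancel-multiple x t (suc q) _ eq = trans (ℕₚ.+-cancelʳ-≡ t x (q ℕ.* t) (trans eq (ℕₚ.+-comm t (q ℕ.* t)))) (ℕₚ.*-comm q t)

      1<p : 1 ℕ.< p
      1<p = prime>1 p-prime

      1<q : 1 ℕ.< q
      1<q = prime>1 q-prime

      p*q∣ : ∀ {i} → p ∣ i → q ∣ i → p ℕ.* q ∣ i
      p*q∣ p∣i q∣i = subst (_∣ _) lcm≡p*q (lcm-least p∣i q∣i)
        where
        gcd≡1 : gcd p q ≡ 1
        gcd≡1 = coprime⇒gcd≡1 (Coprimality.sym (prime⇒coprime q-prime {{ℕ.>-nonZero (ℕₚ.<-trans (ℕ.s≤s ℕ.z≤n) 1<p)}} p<q))
        lcm≡p*q : lcm p q ≡ p ℕ.* q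
        lcm≡p*q = trans (sym (ℕₚ.*-identityˡ (lcm p q))) (trans (cong (ℕ._* lcm p q) (sym gcd≡1)) (gcd*lcm p q))

      both-divide : ∀ i → does (p ∣? i) ∧ does (q ∣? i) ≡ does (p ℕ.* q ∣? i)
      both-divide i with p ∣? i | q ∣? i
      ... | yes p∣i | yes q∣i = sym (dec-true (p ℕ.* q ∣? i) (p*q∣ p∣i q∣i))
      ... | yes _   | no  q∤i = sym (dec-false (p ℕ.* q ∣? i) (λ pq∣i → q∤i (∣-trans (n∣m*n p) pq∣i)))
      ... | no  p∤i | _       = sym (dec-false (p ℕ.* q ∣? i) (λ pq∣i → p∤i (∣-trans (m∣m*n q) pq∣i)))

    count-kind : ∀ l → count n kind l ≡ sumBelow n (λ i → δ (kindOf i) l)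
    count-kind l = sum-toℕ n (λ i → δ (kindOf i) l)

    count-byPQ : count n kind (true , true) ≡ t
    count-byPQ = begin
        count n kind (true , true)                      ≡⟨ count-kind (true , true) ⟩
        sumBelow n (λ i → δ (kindOf i) (true , true))
      ≡⟨ sumBelow-cong n (λ i → trans (proj₂ (proj₂ (proj₂ (indicators (does (p ∣? i)) (does (q ∣? i)))))) (cong ind (both-divide i))) ⟩
        sumBelow n (λ i → ind (does (p ℕ.* q ∣? i)))
      ≡⟨ multiples (p ℕ.* q) t (ℕₚ.*-mono-≤ (ℕₚ.<⇒≤ 1<p) (ℕₚ.<⇒≤ 1<q)) n≡pqt ⟩
        t ∎
      where open ≡-Reasoning

    private
      count-multiplesOf-p : count n kind (true , false) ℕ.+ count n kind (true , true) ≡ q ℕ.* t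
      count-multiplesOf-p = begin
          count n kind (true , false) ℕ.+ count n kind (true , true)
        ≡⟨ cong₂ ℕ._+_ (count-kind (true , false)) (count-kind (true , true)) ⟩
          sumBelow n (λ i → δ (kindOf i) (true , false)) ℕ.+ sumBelow n (λ i → δ (kindOf i) (true , true))
        ≡⟨ sumBelow-+ n (λ i → δ (kindOf i) (true , false)) (λ i → δ (kindOf i) (true , true)) ⟨
          sumBelow n (λ i → δ (kindOf i) (true , false) ℕ.+ δ (kindOf i) (true , true))
        ≡⟨ sumBelow-cong n (λ i → proj₁ (proj₂ (indicators (does (p ∣? i)) (does (q ∣? i))))) ⟩
          sumBelow n (λ i → ind (does (p ∣? i)))
        ≡⟨ multiples p (q ℕ.* t) (ℕₚ.<⇒≤ 1<p) n≡p[qt] ⟩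
          q ℕ.* t ∎
        where open ≡-Reasoning

      count-multiplesOf-q : count n kind (false , true) ℕ.+ count n kind (true , true) ≡ p ℕ.* t
      count-multiplesOf-q = begin
          count n kind (false , true) ℕ.+ count n kind (true , true)
        ≡⟨ cong₂ ℕ._+_ (count-kind (false , true)) (count-kind (true , true)) ⟩
          sumBelow n (λ i → δ (kindOf i) (false , true)) ℕ.+ sumBelow n (λ i → δ (kindOf i) (true , true))
        ≡⟨ sumBelow-+ n (λ i → δ (kindOf i) (false , true)) (λ i → δ (kindOf i) (true , true)) ⟨
          sumBelow n (λ i → δ (kindOf i) (false , true) ℕ.+ δ (kindOf i) (true , true))
        ≡⟨ sumBelow-cong n (λ i → proj₁ (proj₂ (proj₂ (indicators (does (p ∣? i)) (does (q ∣? i)))))) ⟩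
          sumBelow n (λ i → ind (does (q ∣? i)))
        ≡⟨ multiples q (p ℕ.* t) (ℕₚ.<⇒≤ 1<q) n≡q[pt] ⟩
          p ℕ.* t ∎
        where open ≡-Reasoning

    count-byP : count n kind (true , false) ≡ t ℕ.* (q ∸ 1)
    count-byP = cancel-multiple _ t q (ℕₚ.<⇒≤ 1<q) (trans (cong (count n kind (true , false) ℕ.+_) (sym count-byPQ)) count-multiplesOf-p)

    count-byQ : count n kind (false , true) ≡ t ℕ.* (p ∸ 1)
    count-byQ = cancel-multiple _ t p (ℕₚ.<⇒≤ 1<p) (trans (cong (count n kind (false , true) ℕ.+_) (sym count-byPQ)) count-multiplesOf-q)

    -- 0 and n are both non-units, so counting units in [0, n) or in [1, n] gives the same number
    count-unit : count n kind (false , false) ≡ φ n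
    count-unit = begin
        count n kind (false , false)
      ≡⟨ count-kind (false , false) ⟩
        sumBelow n (λ i → δ (kindOf i) (false , false))
      ≡⟨ sumBelow-cong n (λ i → trans (proj₁ (indicators (does (p ∣? i)) (does (q ∣? i)))) (cong ind (sym (unit-iff i)))) ⟩
        sumBelow n isUnit
      ≡⟨ sumBelow-rotate n isUnit (cong (λ g → ind (does (g ℕ.≟ 1))) (trans (gcd-identityˡ n) (sym gcd[n,n]≡n))) ⟨
        sumBelow n (isUnit ∘ suc)
      ≡⟨ length-filter-applyUpTo (λ k → gcd (suc k) n ℕ.≟ 1) (λ i → i) n ⟨
        φ n ∎
      where
      open ≡-Reasoning
      isUnit : ℕ → ℕ
      isUnit i = ind (does (gcd i n ℕ.≟ 1))
      gcd[n,n]≡n : gcd n n ≡ n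
      gcd[n,n]≡n = ∣-antisym (gcd[m,n]∣m n n) (gcd-greatest ∣-refl ∣-refl)

    1≤t : 1 ≤ t
    1≤t = ℕₚ.n≢0⇒n>0 λ t≡0 → ℕₚ.1+n≢0 (trans n≡pqt (trans (cong (p ℕ.* q ℕ.*_) t≡0) (ℕₚ.*-zeroʳ (p ℕ.* q))))

    kinds-occur : ∀ l → 1 ≤ count n kind l
    kinds-occur (false , false) = subst (λ l → 1 ≤ count n kind l) kind[1] (count-witness n kind (fromℕ< 1<n))
      where
      kind[1] : kind (fromℕ< 1<n) ≡ (false , false)
      kind[1] = trans (cong kindOf (toℕ-fromℕ< 1<n)) (cong₂ _,_ (dec-false (p ∣? 1) (¬∣1 1<p)) (dec-false (q ∣? 1) (¬∣1 1<q)))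
    kinds-occur (true , false) = subst (1 ≤_) (sym count-byP) (ℕₚ.*-mono-≤ 1≤t (ℕₚ.m<n⇒0<n∸m 1<q))
    kinds-occur (false , true) = subst (1 ≤_) (sym count-byQ) (ℕₚ.*-mono-≤ 1≤t (ℕₚ.m<n⇒0<n∸m 1<p))
    kinds-occur (true , true)  = subst (1 ≤_) (sym count-byPQ) 1≤t

    W : Kind → ℤ
    W = byKind (+ φ n) (+ (t ℕ.* (q ∸ 1))) (+ (t ℕ.* (p ∸ 1))) (+ t)

    weight-kind : ∀ l → weight n kind (λ _ → + 1) l ≡ W l
    weight-kind (false , false) = trans (weight-ones n kind _) (cong +_ count-unit)
    weight-kind (true , false)  = trans (weight-ones n kind _) (cong +_ count-byP)
    weight-kind (false , true)  = trans (weight-ones n kind _) (cong +_ count-byQ)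
    weight-kind (true , true)   = trans (weight-ones n kind _) (cong +_ count-byPQ)

    degree : ∀ x → deg n x ≡ ΣKind (λ l → comaximal (kind x) l * W l) - comaximal (kind x) (kind x) * + 1
    degree x = begin
        ΣFin n (λ y → b2z (comaxAdj n x y))
      ≡⟨ Σ-cong n (λ y → trans (cong b2z (comaxAdj-kind x y)) (off-diagonal (does (x ≟ y)) (kind y))) ⟩
        ΣFin n (λ y → if does (x ≟ y) then + 0 else comaximal (kind x) (kind y) * + 1)
      ≡⟨ Σ-skip n x (λ y → comaximal (kind x) (kind y) * + 1) ⟩
        ΣFin n (λ y → comaximal (kind x) (kind y) * + 1) - comaximal (kind x) (kind x) * + 1
      ≡⟨ cong (_- comaximal (kind x) (kind x) * + 1)
              (trans (Σ-byKind n kind (comaximal (kind x)) (λ _ → + 1)) (ΣKind-cong λ l → cong (comaximal (kind x) l *_) (weight-kind l))) ⟩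
        ΣKind (λ l → comaximal (kind x) l * W l) - comaximal (kind x) (kind x) * + 1 ∎
      where
      open ≡-Reasoning
      off-diagonal : ∀ b l → b2z (not b ∧ comaximalᵇ (kind x) l) ≡ (if b then + 0 else comaximal (kind x) l * + 1)
      off-diagonal true  l = refl
      off-diagonal false l = sym (*-identityʳ _)

    module _ (z : ℤ) where

      open ClassMatrix (shifted z W) comaximal

      charMatrix-entry : ∀ x y → (if does (x ≟ y) then z else + 0) - laplacian n x y ≡ classMatrix n kind (λ _ → + 1) x y
      charMatrix-entry x y = trans (cong (λ b → (if does (x ≟ y) then z else + 0) - ((if does (x ≟ y) then deg n x else + 0) - b2z b))
                                         (comaxAdj-kind x y))
                                   (by-diagonal (x ≟ y))
        where
        on-diagonal : ∀ z s c → z - ((s - c * + 1) - + 0) ≡ (z - s) + c * + 1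
        on-diagonal = solve-∀
        off-diagonal : ∀ c → + 0 - (+ 0 - c) ≡ + 0 + c * + 1
        off-diagonal = solve-∀
        by-diagonal : (x≟y : Dec (x ≡ y)) →
          (if does x≟y then z else + 0) - ((if does x≟y then deg n x else + 0) - b2z (not (does x≟y) ∧ comaximalᵇ (kind x) (kind y)))
          ≡ (if does x≟y then shifted z W (kind x) else + 0) + comaximal (kind x) (kind y) * + 1
        by-diagonal (yes refl) = trans (cong (λ d → z - (d - + 0)) (degree x)) (on-diagonal z _ (comaximal (kind x) (kind x)))
        by-diagonal (no _)     = off-diagonal (comaximal (kind x) (kind y))

      charPoly-factorisation :
        charPolyL n z ≡ (z - + n) ^ φ n
                      * (z - + (t ℕ.* (p ∸ 1) ℕ.+ φ n)) ^ (t ℕ.* (q ∸ 1) ∸ 1) * (z - + (t ℕ.* (q ∸ 1) ℕ.+ φ n)) ^ (t ℕ.* (p ∸ 1) ∸ 1)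
                      * (z - + φ n) ^ t * (z - + (t ℕ.* ((p ℕ.+ q) ∸ 2) ℕ.+ φ n)) * (z - + 0)
      charPoly-factorisation = begin
          charPolyL n z
        ≡⟨ det-cong n charMatrix-entry ⟩
          det n (classMatrix n kind (λ _ → + 1))
        ≡⟨ DetFormula.holds (det-classMatrix n kind (λ _ → + 1) kinds-occur) ⟩
          ΠKind (λ l → shifted z W l ^ (count n kind l ∸ 1)) * quotientDet (weight n kind (λ _ → + 1))
        ≡⟨ cong₂ _*_ (ΠKind-cong λ l → cong (λ e → shifted z W l ^ (e ∸ 1)) (counts l))
                     (quotientDet-cong {weight n kind (λ _ → + 1)} {W} weight-kind) ⟩
          ΠKind (λ l → shifted z W l ^ (byKind f a b t l ∸ 1)) * quotientDet W
        ≡⟨ spectrum-factorisation z f a b t (subst (1 ≤_) count-unit (kinds-occur (false , false))) 1≤t ⟩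
          (z - + (f ℕ.+ a ℕ.+ b ℕ.+ t)) ^ f * (z - + (b ℕ.+ f)) ^ (a ∸ 1) * (z - + (a ℕ.+ f)) ^ (b ∸ 1)
            * (z - + f) ^ t * (z - + (a ℕ.+ b ℕ.+ f)) * (z - + 0)
        ≡⟨ cong₂ (λ N s → (z - + N) ^ f * (z - + (b ℕ.+ f)) ^ (a ∸ 1) * (z - + (a ℕ.+ f)) ^ (b ∸ 1) * (z - + f) ^ t * (z - + (s ℕ.+ f)) * (z - + 0))
                 total (*-pred-sum t p q (ℕₚ.<⇒≤ 1<p) (ℕₚ.<⇒≤ 1<q)) ⟩
          (z - + n) ^ f * (z - + (b ℕ.+ f)) ^ (a ∸ 1) * (z - + (a ℕ.+ f)) ^ (b ∸ 1)
            * (z - + f) ^ t * (z - + (t ℕ.* ((p ℕ.+ q) ∸ 2) ℕ.+ f)) * (z - + 0) ∎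
        where
        open ≡-Reasoning
        f a b : ℕ
        f = φ n
        a = t ℕ.* (q ∸ 1)
        b = t ℕ.* (p ∸ 1)
        counts : ∀ l → count n kind l ≡ byKind f a b t l
        counts (false , false) = count-unit
        counts (true , false)  = count-byP
        counts (false , true)  = count-byQ
        counts (true , true)   = count-byPQ
        total : f ℕ.+ a ℕ.+ b ℕ.+ t ≡ n
        total = trans (sym (cong₂ ℕ._+_ (cong₂ ℕ._+_ (cong₂ ℕ._+_ (counts _) (counts _)) (counts _)) (counts _))) (count-total n kind)

open import Data.Nat using (zero; suc)
import Data.Nat.Properties as ℕₚ
import Data.Nat.Tactic.RingSolver as ℕ-Solver
open import Data.Nat.Primality using (prime⇒nonZero)
open import Data.Nat.Coprimality using (Coprime)
open import Relation.Binary.PropositionalEquality using (sym; trans; subst)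
open import Relation.Nullary using (contradiction)
open Comaximality using (¬∣⇒coprime; coprime-*ʳ; coprime-^ʳ)
open Spectrum using (module ComaximalGraph)

theorem3p12 : (p q α β : ℕ) → Prime p → Prime q → p < q → 1 ≤ α → 1 ≤ β →
    let n  = p N.^ α N.* q N.^ β
        t1 = p N.^ (α ∸ 1) N.* q N.^ (β ∸ 1)
        f  = φ n
    in (z : ℤ) → charPolyL n z ≡
         (z - + n) ^ f
         Z.* (z - + (t1 N.* (p ∸ 1) N.+ f)) ^ (t1 N.* (q ∸ 1) ∸ 1)
         Z.* (z - + (t1 N.* (q ∸ 1) N.+ f)) ^ (t1 N.* (p ∸ 1) ∸ 1)
         Z.* (z - + f) ^ t1
         Z.* (z - + (t1 N.* ((p N.+ q) ∸ 2) N.+ f))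
         Z.* (z - + 0)
theorem3p12 p q (suc α) (suc β) p-prime q-prime p<q _ _ z with p N.^ suc α N.* q N.^ suc β in n≡
-- comaxAdj, hence charPolyL, is defined by matching on n, which must therefore be exposed as a successor.
... | zero  = contradiction (sym n≡) (ℕₚ.<⇒≢ positive)
  where
  positive : 0 < p N.^ suc α N.* q N.^ suc β
  positive = ℕₚ.*-mono-≤ (ℕₚ.m^n>0 p {{prime⇒nonZero p-prime}} (suc α)) (ℕₚ.m^n>0 q {{prime⇒nonZero q-prime}} (suc β))
... | suc m = ComaximalGraph.charPoly-factorisation p q m (p N.^ α N.* q N.^ β) p-prime q-prime p<q
                (trans (sym n≡) (regroup p q (p N.^ α) (q N.^ β)))
                (λ w p∤w q∤w → subst (Coprime w) n≡
                   (coprime-*ʳ (coprime-^ʳ (¬∣⇒coprime w p-prime p∤w) (suc α)) (coprime-^ʳ (¬∣⇒coprime w q-prime q∤w) (suc β))))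
                z
  where
  regroup : ∀ p q x y → p N.* x N.* (q N.* y) ≡ p N.* q N.* (x N.* y)
  regroup = ℕ-Solver.solve-∀
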